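{- Let $r\geq 3$ and $E=\{x_1,\dots,x_r,y_1,\dots,y_r,t\}$ (a set of $2r+1$ distinct elements), and put $Y=\{y_1,\dots,y_r\}$. Define $\varphi_1=\{\{t,x_i,y_i\}:1\leq i\leq r\}$; $\varphi_2=\{\{x_i,y_i,x_j,y_j\}:1\leq i<j\leq r\}$; $\varphi_3=\{Z\subseteq E: |Z|=r,\ |Z\cap Y| \text{ is odd, and } |Z\cap\{x_i,y_i\}|=1 \text{ for all } 1\leq i\leq r\}$; $\varphi_4=\{E-C: C\in\varphi_3\}$ if $r$ is odd, and $\varphi_4=\{(E-C)\,\Delta\,\{x_{r-1},y_{r-1}\}: C\in\varphi_3\}$ if $r$ is even. If $M$ is a matroid on $E$ whose collection of circuits is exactly $\varphi_1\cup\varphi_2\cup\varphi_3\cup\varphi_4$, then $M$ is the rank-$r$ binary spike, i.e. $M$ is a binary matroid which is a rank-$r$ spike with tip $t$ and legs $\{t,x_i,y_i\}$, $1\le i\le r$.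
   Context: Rank-$r$ spike ($r\ge 3$): on $E=\{x_1,\dots,x_r,y_1,\dots,y_r,t\}$, let $\mathcal C_1=\{\{t,x_i,y_i\}\}$, $\mathcal C_2=\{\{x_i,y_i,x_j,y_j\}:i<j\}$, let $\mathcal C_3$ be a (possibly empty) family of sets $\{z_1,\dots,z_r\}$ with $z_i\in\{x_i,y_i\}$ for all $i$, no two of which share more than $r-2$ elements, and let $\mathcal C_4$ be all $(r+1)$-element subsets of $E$ containing no member of $\mathcal C_1\cup\mathcal C_2\cup\mathcal C_3$. A matroid on $E$ with circuit set $\mathcal C_1\cup\mathcal C_2\cup\mathcal C_3\cup\mathcal C_4$ is a rank-$r$ spike with tip $t$ and legs $L_i=\{t,x_i,y_i\}$. The rank-$r$ binary spike $Z_r$ is the vector matroid over $GF(2)$ of the $r\times(2r+1)$ matrix $[I_r\,|\,J_r-I_r\,|\,\mathbf 1]$ ($J_r$ the all-ones $r\times r$ matrix, $\mathbf 1$ the all-ones column), with columns labeled in order $x_1,\dots,x_r,y_1,\dots,y_r,t$; for each $r\ge3$ it is the unique binary rank-$r$ spike. -}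

module Defs where

open import Data.Bool.Base using (Bool; true; false; not; _∧_; _xor_)
open import Data.Nat.Base using (ℕ; zero; suc; _+_; _∸_; _≤_; _%_)
open import Data.Fin.Base using (Fin; zero; suc; toℕ; _↑ˡ_; _↑ʳ_; splitAt; _<_)
open import Data.Fin.Subset using (Subset; ⁅_⁆; _∈_; _⊆_; _⊂_; ∁; _∩_; _∪_; _-_; ∣_∣; Nonempty; ⊥)
open import Data.Fin.Properties using (_≟_)
open import Data.Vec.Base using (Vec; []; _∷_; tabulate; zipWith)
open import Data.Sum.Base using (_⊎_; inj₁; inj₂)
open import Data.Product.Base using (Σ; ∃; ∃-syntax; _×_; _,_)
open import Relation.Binary.PropositionalEquality using (_≡_; _≢_)
open import Relation.Nullary using (¬_; does)
open import Function.Bundles using (_⇔_)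

record Matroid (n : ℕ) : Set₁ where
  field
    Circuit   : Subset n → Set
    empty-not : ¬ Circuit ⊥
    incomparable : ∀ C D → Circuit C → Circuit D → C ⊆ D → C ≡ D
    elimination : ∀ C D e → Circuit C → Circuit D → C ≢ D → e ∈ C → e ∈ D →
                  ∃[ F ] (Circuit F × F ⊆ ((C ∪ D) - e))
open Matroid public

sumOver : ∀ {n} → Subset n → (Fin n → Bool) → Bool
sumOver []          f = false
sumOver (b ∷ bs) f = (b ∧ f zero) xor sumOver bs (λ j → f (suc j))

ZeroSum : ∀ {m n} → (Fin m → Fin n → Bool) → Subset n → Set
ZeroSum A S = ∀ k → sumOver S (A k) ≡ false

-- Over GF(2) a set of columns is dependent iff a nonempty subset sums to 0;
-- so the circuits (minimal nonempty dependent sets) of M[A] are the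
-- nonempty zero-sum sets no nonempty proper subset of which has zero sum.
VecCircuit : ∀ {m n} → (Fin m → Fin n → Bool) → Subset n → Set
VecCircuit A C = Nonempty C × ZeroSum A C ×
                 (∀ D → D ⊂ C → Nonempty D → ¬ ZeroSum A D)

IsBinary : ∀ {n} → Matroid n → Set
IsBinary {n} M = ∃[ m ] Σ (Fin m → Fin n → Bool) λ A →
                 ∀ C → Circuit M C ⇔ VecCircuit A C

-- Ground set E = {x_1..x_r, y_1..y_r, t} realised as Fin (r + r + 1):
-- x_i ↦ i, y_i ↦ r + i, t ↦ 2r   (indices i : Fin r are 0-based).

El : ℕ → Set
El r = Fin (r + r + 1)

xe : ∀ {r} → Fin r → El r
xe {r} i = (i ↑ˡ r) ↑ˡ 1

ye : ∀ {r} → Fin r → El r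
ye {r} i = (r ↑ʳ i) ↑ˡ 1

te : ∀ {r} → El r
te {r} = (r + r) ↑ʳ zero

pair : ∀ {r} → Fin r → Subset (r + r + 1)
pair {r} i = ⁅ xe {r} i ⁆ ∪ ⁅ ye {r} i ⁆

leg : ∀ {r} → Fin r → Subset (r + r + 1)
leg {r} i = ⁅ te {r} ⁆ ∪ pair {r} i

Yset : ∀ r → Subset (r + r + 1)
Yset r = tabulate λ e → Yel e
  where
  Yel : El r → Bool
  Yel e with splitAt (r + r) e
  ... | inj₂ _ = false
  ... | inj₁ e′ with splitAt r e′
  ...   | inj₁ _ = false
  ...   | inj₂ _ = true

_Δ_ : ∀ {n} → Subset n → Subset n → Subset n
A Δ B = zipWith _xor_ A B

φ₁ : ∀ r → Subset (r + r + 1) → Set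
φ₁ r C = ∃[ i ] C ≡ leg {r} i

φ₂ : ∀ r → Subset (r + r + 1) → Set
φ₂ r C = ∃[ i ] ∃[ j ] (i < j × C ≡ pair {r} i ∪ pair {r} j)

φ₃ : ∀ r → Subset (r + r + 1) → Set
φ₃ r Z = ∣ Z ∣ ≡ r × ∣ Z ∩ Yset r ∣ % 2 ≡ 1 × (∀ i → ∣ Z ∩ pair {r} i ∣ ≡ 1)

-- r odd : E − C ;  r even : (E − C) Δ {x_{r-1}, y_{r-1}}
-- (x_{r-1} is the 0-based index j with toℕ j ≡ r ∸ 2)
φ₄ : ∀ r → Subset (r + r + 1) → Set
φ₄ r D = ∃[ C ] (φ₃ r C ×
           ((r % 2 ≡ 1 × D ≡ ∁ C) ⊎
            (r % 2 ≡ 0 × ∃[ j ] (toℕ {r} j ≡ r ∸ 2 × D ≡ ∁ C Δ pair {r} j))))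

φ : ∀ r → Subset (r + r + 1) → Set
φ r C = φ₁ r C ⊎ φ₂ r C ⊎ φ₃ r C ⊎ φ₄ r C

-- {z_1,…,z_r} with z_i ∈ {x_i, y_i}; b i = true means z_i = y_i
transversal : ∀ {r} → (Fin r → Bool) → Subset (r + r + 1)
transversal {r} b = tabulate λ e → memb e
  where
  memb : El r → Bool
  memb e with splitAt (r + r) e
  ... | inj₂ _ = false
  ... | inj₁ e′ with splitAt r e′
  ...   | inj₁ i = not (b i)
  ...   | inj₂ i = b i

Transversal : ∀ r → Subset (r + r + 1) → Set
Transversal r Z = ∃[ b ] Z ≡ transversal {r} b

𝒞₁ : ∀ r → Subset (r + r + 1) → Set
𝒞₁ = φ₁

𝒞₂ : ∀ r → Subset (r + r + 1) → Set
𝒞₂ = φ₂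

𝒞₄ : ∀ r → (Subset (r + r + 1) → Set) → Subset (r + r + 1) → Set
𝒞₄ r 𝒞₃ C = ∣ C ∣ ≡ suc r ×
             (∀ D → D ⊆ C → ¬ (𝒞₁ r D ⊎ 𝒞₂ r D ⊎ 𝒞₃ D))

IsSpike : ∀ r → Matroid (r + r + 1) → Set₁
IsSpike r M = Σ (Subset (r + r + 1) → Set) λ 𝒞₃ →
  (∀ Z → 𝒞₃ Z → Transversal r Z) ×
  (∀ Z Z′ → 𝒞₃ Z → 𝒞₃ Z′ → Z ≢ Z′ → ∣ Z ∩ Z′ ∣ ≤ r ∸ 2) ×
  (∀ C → Circuit M C ⇔ (𝒞₁ r C ⊎ 𝒞₂ r C ⊎ 𝒞₃ C ⊎ 𝒞₄ r 𝒞₃ C))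

-- The binary spike Z_r: GF(2) matrix [I_r | J_r − I_r | 1].

Zmat : ∀ r → Fin r → El r → Bool
Zmat r k e with splitAt (r + r) e
... | inj₂ _ = true
... | inj₁ e′ with splitAt r e′
...   | inj₁ i = does (k ≟ i)
...   | inj₂ i = not (does (k ≟ i))

-- Identify a subset of E with its coordinates (X, Y, t): the indices of its x's, of its y's,
-- and whether it contains t. The columns of Z_r are e_i at x_i, 𝟙 + e_i at y_i and 𝟙 at t, so
-- a set sums to zero iff X Δ Y is constant on every row, equal to t + |Y| (mod 2). Hence the
-- zero-sum sets are the unions of pairs {x_i, y_i}, containing t iff there is an odd number of
-- pairs, and the transversals of the pairs, containing t iff they have an even number of y's.
-- The minimal nonempty ones are the legs, the unions of two pairs (other pair unions contain one
-- of these) and all the transversal ones (no zero-sum set sits properly inside a transversal);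
-- the transversal circuits without t form φ₃ and those with t form φ₄. So φ is the set of
-- circuits of Z_r, and as φ₄ is also the family of (r + 1)-sets containing no leg, no union of
-- two pairs and no member of φ₃, Z_r is a spike with 𝒞₃ = φ₃.

module Submission where

open import Algebra.Bundles using (CommutativeRing)
open import Data.Bool.Base using (Bool; true; false; not; _∧_; _∨_; _xor_; if_then_else_; T)
open import Data.Bool.Properties
  using (not-involutive; xor-assoc; xor-comm; xor-same; xor-identityʳ; xor-inverseˡ; xor-inverseʳ; ∧-identityʳ; ∧-zeroʳ;
         ∧-distribˡ-xor; ∧-distribʳ-xor; not-distribˡ-xor; ¬-not; xor-∧-commutativeRing)
  renaming (_≟_ to _≟ᵇ_)
open import Algebra.Properties.CommutativeSemigroup (CommutativeRing.+-commutativeSemigroup xor-∧-commutativeRing)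
  using () renaming (interchange to xor-interchange)
open import Data.Nat.Base using (ℕ; zero; suc; _+_; _∸_; _≤_; _<_; _%_; z≤n; s≤s)
open import Data.Nat.Properties
  using (+-suc; +-comm; +-identityʳ; +-cancelˡ-≡; +-monoʳ-≤; suc-injective; m∸n+n≡m; ∸-monoʳ-<; m+n≤o⇒m≤o∸n;
         1+n≰n; <⇒≱; <⇒≤; ≤-reflexive; m<n⇒0<n; module ≤-Reasoning)
open import Data.Nat.DivMod using (%-distribˡ-+)
open import Data.Fin.Base using (Fin; zero; suc; _↑ˡ_; _↑ʳ_; fromℕ<)
open import Data.Fin.Properties using (splitAt-↑ˡ; splitAt-↑ʳ; <-cmp; <⇒≢; toℕ-fromℕ<) renaming (_≟_ to _≟ᶠ_)
open import Data.Fin.Subset using (Subset; ⁅_⁆; _∈_; _⊆_; _⊂_; ∁; _∩_; _∪_; ∣_∣; Nonempty; ⊥; ⊤)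
open import Data.Fin.Subset.Properties
  using (drop-∷-⊆; s⊂s; out⊂in; ∉⊥; ∈⊤; ⊆⊤; ⊆-refl; ⊆-trans; ⊆-antisym; nonempty?; Empty-unique; x∈⁅x⁆; x∈⁅y⁆⇒x≡y;
         x∉⁅y⁆⇒x≢y; x∈p∪q⁻; p⊆p∪q; x∈p∩q⁺; x∈p∩q⁻; x∈p⇒x∉∁p; x∉p⇒x∈∁p; ∁p⊆∁q⇒p⊇q; p∪∁p≡⊤; ∪-comm;
         ∪-identityˡ; ∪-identityʳ; ∩-zeroʳ; ∩-identityʳ; p⊆q⇒∣p∣≤∣q∣; p⊂q⇒∣p∣<∣q∣; ∣p∣≤n; ∣∁p∣≡n∸∣p∣; ∣⁅x⁆∣≡1;
         ∣⊥∣≡0; ∣⊤∣≡n; ∣p∣≡n⇒p≡⊤)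
open import Data.Vec.Base using (Vec; []; _∷_; _++_; here; there; lookup; tabulate; zipWith; splitAt)
open import Data.Vec.Properties
  using (≡-dec; ∷-injectiveˡ; ++-injective; zipWith-++; map-++; lookup-++ˡ; lookup-++ʳ; lookup-map; lookup-replicate;
         lookup∘tabulate; tabulate∘lookup; tabulate-cong; []=⇒lookup; lookup⇒[]=)
open import Data.Vec.Relation.Binary.Pointwise.Extensional using (ext; Pointwise-≡⇒≡)
open import Data.Product.Base using (_×_; _,_; ∃; ∃-syntax; proj₁; proj₂)
open import Data.Sum.Base using (_⊎_; inj₁; inj₂)
open import Data.Sum.Function.Propositional using (_⊎-⇔_)
open import Data.Empty using (⊥-elim)
open import Relation.Binary.Definitions using (tri<; tri≈; tri>)
open import Relation.Binary.PropositionalEquality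
open import Relation.Nullary using (¬_; does; yes; no)
open import Function.Base using (_∘_; id)
open import Function.Bundles using (_⇔_; mk⇔; Equivalence)
open import Function.Properties.Equivalence using () renaming (refl to ⇔-refl; sym to ⇔-sym; trans to ⇔-trans)
open import Defs

open Equivalence using (to; from)

private variable
  m n r : ℕ
  X X′ Y Y′ : Subset r
  t t′ : Bool

true≢false : true ≢ false
true≢false ()

xor≡false⇒≡ : ∀ {a b} → a xor b ≡ false → a ≡ b
xor≡false⇒≡ {true}  {true}  _ = refl
xor≡false⇒≡ {false} {false} _ = refl

xor≡true⇒≡not : ∀ {a b} → a xor b ≡ true → a ≡ not b
xor≡true⇒≡not {true}  {false} _ = refl
xor≡true⇒≡not {false} {true}  _ = refl

tabulate-++ : ∀ {A : Set} m {n} (f : Fin (m + n) → A) →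
              tabulate f ≡ tabulate (f ∘ (_↑ˡ n)) ++ tabulate (f ∘ (m ↑ʳ_))
tabulate-++ zero    f = refl
tabulate-++ (suc m) f = cong (f zero ∷_) (tabulate-++ m (f ∘ suc))

⊥-++ : ∀ m {n} → ⊥ {m + n} ≡ ⊥ {m} ++ ⊥ {n}
⊥-++ zero    = refl
⊥-++ (suc m) = cong (false ∷_) (⊥-++ m)

∣p++q∣≡∣p∣+∣q∣ : (p : Subset m) (q : Subset n) → ∣ p ++ q ∣ ≡ ∣ p ∣ + ∣ q ∣
∣p++q∣≡∣p∣+∣q∣ []          q = refl
∣p++q∣≡∣p∣+∣q∣ (true ∷ p)  q = cong suc (∣p++q∣≡∣p∣+∣q∣ p q)
∣p++q∣≡∣p∣+∣q∣ (false ∷ p) q = ∣p++q∣≡∣p∣+∣q∣ p q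

sumOver-++ : (p : Subset m) (q : Subset n) (f : Fin (m + n) → Bool) →
             sumOver (p ++ q) f ≡ sumOver p (f ∘ (_↑ˡ n)) xor sumOver q (f ∘ (m ↑ʳ_))
sumOver-++ []      q f = refl
sumOver-++ (b ∷ p) q f =
  trans (cong ((b ∧ f zero) xor_) (sumOver-++ p q (f ∘ suc))) (sym (xor-assoc (b ∧ f zero) _ _))

module _ (p : Subset m) (q : Subset n) where

  ∈-++⁺ˡ : ∀ {x} → x ∈ p → x ↑ˡ n ∈ p ++ q
  ∈-++⁺ˡ x∈p = lookup⇒[]= _ _ (trans (lookup-++ˡ p q _) ([]=⇒lookup x∈p))

  ∈-++⁻ˡ : ∀ {x} → x ↑ˡ n ∈ p ++ q → x ∈ p
  ∈-++⁻ˡ x∈ = lookup⇒[]= _ _ (trans (sym (lookup-++ˡ p q _)) ([]=⇒lookup x∈))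

  ∈-++⁺ʳ : ∀ {y} → y ∈ q → m ↑ʳ y ∈ p ++ q
  ∈-++⁺ʳ y∈q = lookup⇒[]= _ _ (trans (lookup-++ʳ p q _) ([]=⇒lookup y∈q))

  ∈-++⁻ʳ : ∀ {y} → m ↑ʳ y ∈ p ++ q → y ∈ q
  ∈-++⁻ʳ y∈ = lookup⇒[]= _ _ (trans (sym (lookup-++ʳ p q _)) ([]=⇒lookup y∈))

++-⊆⁺ : {p p′ : Subset m} {q q′ : Subset n} → p ⊆ p′ → q ⊆ q′ → p ++ q ⊆ p′ ++ q′
++-⊆⁺ {p = []}    {[]}     _    q⊆q′ x∈ = q⊆q′ x∈
++-⊆⁺ {p = _ ∷ _} {_ ∷ _}  p⊆p′ _    here with p⊆p′ here
... | here = here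
++-⊆⁺ {p = _ ∷ _} {_ ∷ _}  p⊆p′ q⊆q′ (there x∈) = there (++-⊆⁺ (drop-∷-⊆ p⊆p′) q⊆q′ x∈)

++-⊆⁻ : (p p′ : Subset m) {q q′ : Subset n} → p ++ q ⊆ p′ ++ q′ → p ⊆ p′ × q ⊆ q′
++-⊆⁻ p p′ {q} {q′} h =
  (λ x∈ → ∈-++⁻ˡ p′ q′ (h (∈-++⁺ˡ p q x∈))) , (λ y∈ → ∈-++⁻ʳ p′ q′ (h (∈-++⁺ʳ p q y∈)))

⁅x↑ˡ⁆≡⁅x⁆++⊥ : (x : Fin m) → ⁅ x ↑ˡ n ⁆ ≡ ⁅ x ⁆ ++ ⊥ {n}
⁅x↑ˡ⁆≡⁅x⁆++⊥ {n = n} zero    = cong (true ∷_) (⊥-++ _ {n})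
⁅x↑ˡ⁆≡⁅x⁆++⊥         (suc x) = cong (false ∷_) (⁅x↑ˡ⁆≡⁅x⁆++⊥ x)

⁅↑ʳx⁆≡⊥++⁅x⁆ : ∀ m (x : Fin n) → ⁅ m ↑ʳ x ⁆ ≡ ⊥ {m} ++ ⁅ x ⁆
⁅↑ʳx⁆≡⊥++⁅x⁆ zero    x = refl
⁅↑ʳx⁆≡⊥++⁅x⁆ (suc m) x = cong (false ∷_) (⁅↑ʳx⁆≡⊥++⁅x⁆ m x)

⊆∧≢⇒⊂ : {p q : Subset n} → p ⊆ q → p ≢ q → p ⊂ q
⊆∧≢⇒⊂ {p = []}         {[]}         _   p≢q = ⊥-elim (p≢q refl)
⊆∧≢⇒⊂ {p = true ∷ _}   {false ∷ _}  p⊆q _   with p⊆q here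
... | ()
⊆∧≢⇒⊂ {p = false ∷ _}  {true ∷ _}   p⊆q _   = out⊂in (drop-∷-⊆ p⊆q)
⊆∧≢⇒⊂ {p = true ∷ _}   {true ∷ _}   p⊆q p≢q = s⊂s (⊆∧≢⇒⊂ (drop-∷-⊆ p⊆q) (p≢q ∘ cong (true ∷_)))
⊆∧≢⇒⊂ {p = false ∷ _}  {false ∷ _}  p⊆q p≢q = s⊂s (⊆∧≢⇒⊂ (drop-∷-⊆ p⊆q) (p≢q ∘ cong (false ∷_)))

x∈p⇒p≢⊥ : {x : Fin n} {p : Subset n} → x ∈ p → p ≢ ⊥
x∈p⇒p≢⊥ x∈p refl = ∉⊥ x∈p

Nonempty⇔≢⊥ : {p : Subset n} → Nonempty p ⇔ p ≢ ⊥
Nonempty⇔≢⊥ {p = p} = mk⇔ (λ (_ , x∈p) → x∈p⇒p≢⊥ x∈p) nonempty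
  where
  nonempty : p ≢ ⊥ → Nonempty p
  nonempty p≢⊥ with nonempty? p
  ... | yes ne = ne
  ... | no ¬ne = ⊥-elim (p≢⊥ (Empty-unique ¬ne))

∣p∣≡0⇒p≡⊥ : {p : Subset n} → ∣ p ∣ ≡ 0 → p ≡ ⊥
∣p∣≡0⇒p≡⊥ {p = []}        _  = refl
∣p∣≡0⇒p≡⊥ {p = false ∷ p} eq = cong (false ∷_) (∣p∣≡0⇒p≡⊥ eq)

∷[]⊆∷[]⇔ : {b c : Bool} → b ∷ [] ⊆ c ∷ [] ⇔ (T b → T c)
∷[]⊆∷[]⇔ = mk⇔ implication containment
  where
  implication : ∀ {b c} → b ∷ [] ⊆ c ∷ [] → T b → T c
  implication {true} b⊆c _ with b⊆c here
  ... | here = _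
  containment : ∀ {b c} → (T b → T c) → b ∷ [] ⊆ c ∷ []
  containment {c = true}  _     here = here
  containment {c = false} Tb⇒Tc here = ⊥-elim (Tb⇒Tc _)

∁-involutive : (p : Subset n) → ∁ (∁ p) ≡ p
∁-involutive []      = refl
∁-involutive (x ∷ p) = cong₂ _∷_ (not-involutive x) (∁-involutive p)

∁≡⊤Δ : (p : Subset n) → ∁ p ≡ ⊤ Δ p
∁≡⊤Δ []      = refl
∁≡⊤Δ (_ ∷ p) = cong (_ ∷_) (∁≡⊤Δ p)

∁-Δ : (p q : Subset n) → ∁ (p Δ q) ≡ ∁ p Δ q
∁-Δ []      []      = refl
∁-Δ (x ∷ p) (y ∷ q) = cong₂ _∷_ (not-distribˡ-xor x y) (∁-Δ p q)

Δ-cancelʳ : (p q : Subset n) → (p Δ q) Δ q ≡ p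
Δ-cancelʳ []      []      = refl
Δ-cancelʳ (x ∷ p) (y ∷ q) = cong₂ _∷_ cancel (Δ-cancelʳ p q)
  where
  cancel : (x xor y) xor y ≡ x
  cancel = trans (xor-assoc x y y) (trans (cong (x xor_) (xor-same y)) (xor-identityʳ x))

Δ≡⊥⇒≡ : {p q : Subset n} → p Δ q ≡ ⊥ → p ≡ q
Δ≡⊥⇒≡ {p = p} {q} pΔq≡⊥ = trans (sym (Δ-cancelʳ p q)) (trans (cong (_Δ q) pΔq≡⊥) (⊥Δ q))
  where
  ⊥Δ : ∀ {n} (q : Subset n) → ⊥ Δ q ≡ q
  ⊥Δ []      = refl
  ⊥Δ (_ ∷ q) = cong (_ ∷_) (⊥Δ q)

Δ⊆∪ : (p q : Subset n) → p Δ q ⊆ p ∪ q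
Δ⊆∪ (true  ∷ p) (false ∷ q) here       = here
Δ⊆∪ (false ∷ p) (true  ∷ q) here       = here
Δ⊆∪ (_     ∷ p) (_     ∷ q) (there x∈) = there (Δ⊆∪ p q x∈)

∪-⊆ : {p q r : Subset n} → p ⊆ r → q ⊆ r → p ∪ q ⊆ r
∪-⊆ {p = p} {q} p⊆r q⊆r x∈ with x∈p∪q⁻ p q x∈
... | inj₁ x∈p = p⊆r x∈p
... | inj₂ x∈q = q⊆r x∈q

⁅x⁆⊆p : {x : Fin n} {p : Subset n} → x ∈ p → ⁅ x ⁆ ⊆ p
⁅x⁆⊆p {x = x} x∈p y∈ = subst (_∈ _) (sym (x∈⁅y⁆⇒x≡y x y∈)) x∈p

∪≡⊤⇒∁⊆ : {p q : Subset n} → p ∪ q ≡ ⊤ → ∁ q ⊆ p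
∪≡⊤⇒∁⊆ {p = p} {q} p∪q≡⊤ x∈∁q with x∈p∪q⁻ p q (subst (_ ∈_) (sym p∪q≡⊤) ∈⊤)
... | inj₁ x∈p = x∈p
... | inj₂ x∈q = ⊥-elim (x∈p⇒x∉∁p x∈q x∈∁q)

∩≡⊥⇒⊆∁ : {p q : Subset n} → p ∩ q ≡ ⊥ → p ⊆ ∁ q
∩≡⊥⇒⊆∁ {p = p} {q} p∩q≡⊥ x∈p = x∉p⇒x∈∁p λ x∈q → ∉⊥ (subst (_ ∈_) p∩q≡⊥ (x∈p∩q⁺ (x∈p , x∈q)))

⁅x⁆∩⁅y⁆≡⊥ : {x y : Fin n} → x ≢ y → ⁅ x ⁆ ∩ ⁅ y ⁆ ≡ ⊥
⁅x⁆∩⁅y⁆≡⊥ {x = x} {y} x≢y = Empty-unique λ (z , z∈) → let z∈x , z∈y = x∈p∩q⁻ ⁅ x ⁆ ⁅ y ⁆ z∈ in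
  x≢y (trans (sym (x∈⁅y⁆⇒x≡y x z∈x)) (x∈⁅y⁆⇒x≡y y z∈y))

∣p∣≤1 : {p : Subset n} → (∀ {x y} → x ∈ p → y ∈ p → x ≡ y) → ∣ p ∣ ≤ 1
∣p∣≤1 {n} {p} unique with nonempty? p
... | yes (x , x∈p) = subst (∣ p ∣ ≤_) (∣⁅x⁆∣≡1 x) (p⊆q⇒∣p∣≤∣q∣ λ y∈p → subst (_∈ ⁅ x ⁆) (unique x∈p y∈p) (x∈⁅x⁆ x))
... | no ¬ne = subst (λ q → ∣ q ∣ ≤ 1) (sym (Empty-unique ¬ne)) (subst (_≤ 1) (sym (∣⊥∣≡0 n)) z≤n)

∣∁p∣+∣p∣≡n : (p : Subset n) → ∣ ∁ p ∣ + ∣ p ∣ ≡ n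
∣∁p∣+∣p∣≡n {n} p = trans (cong (_+ ∣ p ∣) (∣∁p∣≡n∸∣p∣ p)) (m∸n+n≡m (∣p∣≤n p))

∣p∩⁅x⁆∣≡∣[p[x]]∣ : (p : Subset n) (x : Fin n) → ∣ p ∩ ⁅ x ⁆ ∣ ≡ ∣ lookup p x ∷ [] ∣
∣p∩⁅x⁆∣≡∣[p[x]]∣ {suc n} (true  ∷ p) zero    = cong suc (trans (cong ∣_∣ (∩-zeroʳ p)) (∣⊥∣≡0 n))
∣p∩⁅x⁆∣≡∣[p[x]]∣ {suc n} (false ∷ p) zero    = trans (cong ∣_∣ (∩-zeroʳ p)) (∣⊥∣≡0 n)
∣p∩⁅x⁆∣≡∣[p[x]]∣         (true  ∷ p) (suc x) = ∣p∩⁅x⁆∣≡∣[p[x]]∣ p x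
∣p∩⁅x⁆∣≡∣[p[x]]∣         (false ∷ p) (suc x) = ∣p∩⁅x⁆∣≡∣[p[x]]∣ p x

∣p∪q∣+∣p∩q∣≡∣p∣+∣q∣ : (p q : Subset n) → ∣ p ∪ q ∣ + ∣ p ∩ q ∣ ≡ ∣ p ∣ + ∣ q ∣
∣p∪q∣+∣p∩q∣≡∣p∣+∣q∣ []          []          = refl
∣p∪q∣+∣p∩q∣≡∣p∣+∣q∣ (true ∷ p)  (true ∷ q)  =
  cong suc (trans (+-suc _ _) (trans (cong suc (∣p∪q∣+∣p∩q∣≡∣p∣+∣q∣ p q)) (sym (+-suc _ _))))
∣p∪q∣+∣p∩q∣≡∣p∣+∣q∣ (true ∷ p)  (false ∷ q) = cong suc (∣p∪q∣+∣p∩q∣≡∣p∣+∣q∣ p q)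
∣p∪q∣+∣p∩q∣≡∣p∣+∣q∣ (false ∷ p) (true ∷ q)  = trans (cong suc (∣p∪q∣+∣p∩q∣≡∣p∣+∣q∣ p q)) (sym (+-suc _ _))
∣p∪q∣+∣p∩q∣≡∣p∣+∣q∣ (false ∷ p) (false ∷ q) = ∣p∪q∣+∣p∩q∣≡∣p∣+∣q∣ p q

∣∁p∩∁q∣+∣p∩q∣+∣pΔq∣≡n : (p q : Subset n) → ∣ ∁ p ∩ ∁ q ∣ + ∣ p ∩ q ∣ + ∣ p Δ q ∣ ≡ n
∣∁p∩∁q∣+∣p∩q∣+∣pΔq∣≡n []          []          = refl
∣∁p∩∁q∣+∣p∩q∣+∣pΔq∣≡n (true ∷ p)  (true ∷ q)  =
  trans (cong (_+ ∣ p Δ q ∣) (+-suc _ _)) (cong suc (∣∁p∩∁q∣+∣p∩q∣+∣pΔq∣≡n p q))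
∣∁p∩∁q∣+∣p∩q∣+∣pΔq∣≡n (true ∷ p)  (false ∷ q) = trans (+-suc _ _) (cong suc (∣∁p∩∁q∣+∣p∩q∣+∣pΔq∣≡n p q))
∣∁p∩∁q∣+∣p∩q∣+∣pΔq∣≡n (false ∷ p) (true ∷ q)  = trans (+-suc _ _) (cong suc (∣∁p∩∁q∣+∣p∩q∣+∣pΔq∣≡n p q))
∣∁p∩∁q∣+∣p∩q∣+∣pΔq∣≡n (false ∷ p) (false ∷ q) = cong suc (∣∁p∩∁q∣+∣p∩q∣+∣pΔq∣≡n p q)

∣⁅x⁆∪⁅y⁆∣≡2 : {x y : Fin n} → x ≢ y → ∣ ⁅ x ⁆ ∪ ⁅ y ⁆ ∣ ≡ 2
∣⁅x⁆∪⁅y⁆∣≡2 {n} {x} {y} x≢y = begin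
  ∣ ⁅ x ⁆ ∪ ⁅ y ⁆ ∣                          ≡⟨ +-identityʳ _ ⟨
  ∣ ⁅ x ⁆ ∪ ⁅ y ⁆ ∣ + 0                      ≡⟨ cong (∣ ⁅ x ⁆ ∪ ⁅ y ⁆ ∣ +_) (∣⊥∣≡0 n) ⟨
  ∣ ⁅ x ⁆ ∪ ⁅ y ⁆ ∣ + ∣ ⊥ {n} ∣              ≡⟨ cong (λ p → ∣ ⁅ x ⁆ ∪ ⁅ y ⁆ ∣ + ∣ p ∣) (⁅x⁆∩⁅y⁆≡⊥ x≢y) ⟨
  ∣ ⁅ x ⁆ ∪ ⁅ y ⁆ ∣ + ∣ ⁅ x ⁆ ∩ ⁅ y ⁆ ∣      ≡⟨ ∣p∪q∣+∣p∩q∣≡∣p∣+∣q∣ ⁅ x ⁆ ⁅ y ⁆ ⟩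
  ∣ ⁅ x ⁆ ∣ + ∣ ⁅ y ⁆ ∣                      ≡⟨ cong₂ _+_ (∣⁅x⁆∣≡1 x) (∣⁅x⁆∣≡1 y) ⟩
  2                                          ∎
  where open ≡-Reasoning

sumOver-cong : (p : Subset n) {f g : Fin n → Bool} → (∀ i → f i ≡ g i) → sumOver p f ≡ sumOver p g
sumOver-cong []      f≗g = refl
sumOver-cong (b ∷ p) f≗g = cong₂ _xor_ (cong (b ∧_) (f≗g zero)) (sumOver-cong p (f≗g ∘ suc))

sumOver-xor : (p : Subset n) (f g : Fin n → Bool) →
              sumOver p (λ i → f i xor g i) ≡ sumOver p f xor sumOver p g
sumOver-xor []      f g = refl
sumOver-xor (b ∷ p) f g = trans
  (cong₂ _xor_ (∧-distribˡ-xor b (f zero) (g zero)) (sumOver-xor p (f ∘ suc) (g ∘ suc)))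
  (xor-interchange (b ∧ f zero) (b ∧ g zero) _ _)

sumOver-Δ : (p q : Subset n) (f : Fin n → Bool) → sumOver (p Δ q) f ≡ sumOver p f xor sumOver q f
sumOver-Δ []      []      f = refl
sumOver-Δ (x ∷ p) (y ∷ q) f = trans
  (cong₂ _xor_ (∧-distribʳ-xor (f zero) x y) (sumOver-Δ p q (f ∘ suc)))
  (xor-interchange (x ∧ f zero) (y ∧ f zero) _ _)

sumOver-⊥ : (f : Fin n → Bool) → sumOver ⊥ f ≡ false
sumOver-⊥ {zero}  f = refl
sumOver-⊥ {suc n} f = sumOver-⊥ (f ∘ suc)

sumOver-⁅⁆ : (x : Fin n) (f : Fin n → Bool) → sumOver ⁅ x ⁆ f ≡ f x
sumOver-⁅⁆ zero    f = trans (cong (f zero xor_) (sumOver-⊥ (f ∘ suc))) (xor-identityʳ (f zero))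
sumOver-⁅⁆ (suc x) f = sumOver-⁅⁆ x (f ∘ suc)

sumOver-indicator : (p : Subset n) (x : Fin n) → sumOver p (λ i → does (x ≟ᶠ i)) ≡ lookup p x
sumOver-indicator (b ∷ p) zero    = trans
  (cong₂ _xor_ (∧-identityʳ b) (sumOver-false p)) (xor-identityʳ b)
  where
  sumOver-false : ∀ {n} (p : Subset n) → sumOver p (λ _ → false) ≡ false
  sumOver-false []      = refl
  sumOver-false (b ∷ p) = trans (cong (_xor sumOver p _) (∧-zeroʳ b)) (sumOver-false p)
sumOver-indicator (b ∷ p) (suc x) = trans (cong (_xor _) (∧-zeroʳ b)) (sumOver-indicator p x)

parity : Subset n → Bool
parity p = sumOver p (λ _ → true)

parity-⁅⁆ : (x : Fin n) → parity ⁅ x ⁆ ≡ true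
parity-⁅⁆ x = sumOver-⁅⁆ x _

parity-Δ : (p q : Subset n) → parity (p Δ q) ≡ parity p xor parity q
parity-Δ p q = sumOver-Δ p q _

parity-∁ : (p : Subset n) → parity (∁ p) ≡ parity (⊤ {n}) xor parity p
parity-∁ p = trans (cong parity (∁≡⊤Δ p)) (parity-Δ ⊤ p)

∣p∣%2≡parity : (p : Subset n) → ∣ p ∣ % 2 ≡ (if parity p then 1 else 0)
∣p∣%2≡parity []          = refl
∣p∣%2≡parity (false ∷ p) = ∣p∣%2≡parity p
∣p∣%2≡parity (true ∷ p)  = begin
  (1 + ∣ p ∣) % 2                      ≡⟨ %-distribˡ-+ 1 ∣ p ∣ 2 ⟩
  (1 + ∣ p ∣ % 2) % 2                  ≡⟨ cong (λ k → (1 + k) % 2) (∣p∣%2≡parity p) ⟩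
  (1 + (if parity p then 1 else 0)) % 2 ≡⟨ flip (parity p) ⟩
  (if not (parity p) then 1 else 0)    ∎
  where
  open ≡-Reasoning
  flip : ∀ b → (1 + (if b then 1 else 0)) % 2 ≡ (if not b then 1 else 0)
  flip true  = refl
  flip false = refl

parity-from-∣∣ : (p : Subset n) {b : Bool} → ∣ p ∣ % 2 ≡ (if b then 1 else 0) → parity p ≡ b
parity-from-∣∣ p {b} eq = bit-injective (parity p) b (trans (sym (∣p∣%2≡parity p)) eq)
  where
  bit-injective : ∀ a b → (if a then 1 else 0) ≡ (if b then 1 else 0) → a ≡ b
  bit-injective true  true  _ = refl
  bit-injective false false _ = refl

parity-⁅x⁆∪⁅y⁆ : {x y : Fin n} → x ≢ y → parity (⁅ x ⁆ ∪ ⁅ y ⁆) ≡ false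
parity-⁅x⁆∪⁅y⁆ {x = x} {y} x≢y = parity-from-∣∣ (⁅ x ⁆ ∪ ⁅ y ⁆) (cong (_% 2) (∣⁅x⁆∪⁅y⁆∣≡2 x≢y))

-- A nonempty proper subset of a set of size at most 2 is a singleton inside a pair,
-- and these have different parities.
parity-minimal : {p q : Subset n} → ∣ q ∣ ≤ 2 → p ⊆ q → p ≢ ⊥ → (T (parity p) → T (parity q)) → p ≡ q
parity-minimal {p = p} {q} ∣q∣≤2 p⊆q p≢⊥ parity⇒ with ≡-dec _≟ᵇ_ p q
... | yes p≡q = p≡q
... | no  p≢q = ⊥-elim (subst T parity-q (parity⇒ (subst T (sym parity-p) _)))
  where
  squeeze : ∀ {a b} → a ≢ 0 → a < b → b ≤ 2 → a ≡ 1 × b ≡ 2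
  squeeze {zero}        a≢0 _                   _                 = ⊥-elim (a≢0 refl)
  squeeze {suc zero}    _   (s≤s (s≤s z≤n))     (s≤s (s≤s z≤n))   = refl , refl
  squeeze {suc (suc a)} _   (s≤s (s≤s (s≤s _))) (s≤s (s≤s ()))
  sizes : ∣ p ∣ ≡ 1 × ∣ q ∣ ≡ 2
  sizes = squeeze (p≢⊥ ∘ ∣p∣≡0⇒p≡⊥) (p⊂q⇒∣p∣<∣q∣ (⊆∧≢⇒⊂ p⊆q p≢q)) ∣q∣≤2
  parity-p : parity p ≡ true
  parity-p = parity-from-∣∣ p (cong (_% 2) (proj₁ sizes))
  parity-q : parity q ≡ false
  parity-q = parity-from-∣∣ q (cong (_% 2) (proj₂ sizes))

parity≡false⇒2≤∣p∣ : {p : Subset n} → p ≢ ⊥ → parity p ≡ false → 2 ≤ ∣ p ∣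
parity≡false⇒2≤∣p∣ {p = p} p≢⊥ even with ∣ p ∣ in ∣p∣≡
... | 0           = ⊥-elim (p≢⊥ (∣p∣≡0⇒p≡⊥ ∣p∣≡))
... | 1           with () ← trans (sym even) (parity-from-∣∣ p (cong (_% 2) ∣p∣≡))
... | suc (suc _) = s≤s (s≤s z≤n)

module _ {m n} (A : Fin m → Fin n → Bool) {C : Subset n} where

  circuit-intro : Nonempty C → ZeroSum A C → (∀ D → D ⊆ C → Nonempty D → ZeroSum A D → D ≡ C) →
                  VecCircuit A C
  circuit-intro ne zs minimal = ne , zs , λ D (D⊆C , x , x∈C , x∉D) neD zsD →
    x∉D (subst (x ∈_) (sym (minimal D D⊆C neD zsD)) x∈C)

  circuit-minimal : VecCircuit A C → ∀ {D} → D ⊆ C → Nonempty D → ZeroSum A D → D ≡ C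
  circuit-minimal (_ , _ , minimal) {D} D⊆C neD zsD with ≡-dec _≟ᵇ_ D C
  ... | yes D≡C = D≡C
  ... | no  D≢C = ⊥-elim (minimal D (⊆∧≢⇒⊂ D⊆C D≢C) neD zsD)

-- Opaque so that unification treats ⟨ X , Y , t ⟩ as rigid: its unfolding (X ++ Y) ++ [ t ]
-- does not determine X and Y for the unifier.
opaque
  ⟨_,_,_⟩ : Subset r → Subset r → Bool → Subset (r + r + 1)
  ⟨ X , Y , t ⟩ = (X ++ Y) ++ t ∷ []

data Coordinates {r} : Subset (r + r + 1) → Set where
  coordinates : (X Y : Subset r) (t : Bool) → Coordinates ⟨ X , Y , t ⟩

opaque
  unfolding ⟨_,_,_⟩

  coordinatesOf : (S : Subset (r + r + 1)) → Coordinates {r} S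
  coordinatesOf {r} S with splitAt (r + r) S
  ... | XY , t ∷ [] , refl with splitAt r XY
  ...   | X , Y , refl = coordinates X Y t

  ⟨⟩-cong : X ≡ X′ → Y ≡ Y′ → t ≡ t′ → ⟨ X , Y , t ⟩ ≡ ⟨ X′ , Y′ , t′ ⟩
  ⟨⟩-cong refl refl refl = refl

  ⟨⟩-injective : ⟨ X , Y , t ⟩ ≡ ⟨ X′ , Y′ , t′ ⟩ → X ≡ X′ × Y ≡ Y′ × t ≡ t′
  ⟨⟩-injective {X = X} {Y} {X′ = X′} {Y′} eq =
    let XY≡ , t≡ = ++-injective (X ++ Y) (X′ ++ Y′) eq
        X≡ , Y≡ = ++-injective X X′ XY≡
    in X≡ , Y≡ , ∷-injectiveˡ t≡

  ⟨⟩-zipWith : (f : Bool → Bool → Bool) →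
               zipWith f ⟨ X , Y , t ⟩ ⟨ X′ , Y′ , t′ ⟩ ≡ ⟨ zipWith f X X′ , zipWith f Y Y′ , f t t′ ⟩
  ⟨⟩-zipWith {X = X} {Y} {t} {X′} {Y′} {t′} f =
    trans (zipWith-++ f (X ++ Y) (t ∷ []) (X′ ++ Y′) (t′ ∷ []))
          (cong (_++ f t t′ ∷ []) (zipWith-++ f X Y X′ Y′))

  ⟨⟩-∁ : ∁ ⟨ X , Y , t ⟩ ≡ ⟨ ∁ X , ∁ Y , not t ⟩
  ⟨⟩-∁ {X = X} {Y} {t} = trans (map-++ not (X ++ Y) (t ∷ [])) (cong (_++ not t ∷ []) (map-++ not X Y))

  ⟨⟩-⊆ : ⟨ X , Y , t ⟩ ⊆ ⟨ X′ , Y′ , t′ ⟩ ⇔ (X ⊆ X′ × Y ⊆ Y′ × (T t → T t′))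
  ⟨⟩-⊆ {X = X} {Y} {t} {X′} {Y′} {t′} = mk⇔ split (λ (X⊆ , Y⊆ , t⇒) → ++-⊆⁺ (++-⊆⁺ X⊆ Y⊆) (from ∷[]⊆∷[]⇔ t⇒))
    where
    split : ⟨ X , Y , t ⟩ ⊆ ⟨ X′ , Y′ , t′ ⟩ → X ⊆ X′ × Y ⊆ Y′ × (T t → T t′)
    split S⊆S′ = let XY⊆ , t⊆ = ++-⊆⁻ (X ++ Y) (X′ ++ Y′) S⊆S′ ; X⊆ , Y⊆ = ++-⊆⁻ X X′ XY⊆ in
      X⊆ , Y⊆ , to ∷[]⊆∷[]⇔ t⊆

  ∣⟨⟩∣ : ∣ ⟨ X , Y , t ⟩ ∣ ≡ ∣ X ∣ + ∣ Y ∣ + ∣ t ∷ [] ∣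
  ∣⟨⟩∣ {X = X} {Y} {t} = trans (∣p++q∣≡∣p∣+∣q∣ (X ++ Y) (t ∷ [])) (cong (_+ ∣ t ∷ [] ∣) (∣p++q∣≡∣p∣+∣q∣ X Y))

  ⊥≡⟨⊥,⊥,false⟩ : ⊥ ≡ ⟨ ⊥ {r} , ⊥ , false ⟩
  ⊥≡⟨⊥,⊥,false⟩ {r} = trans (⊥-++ (r + r)) (cong (_++ ⊥) (⊥-++ r))

  tabulate-⟨⟩ : ∀ {r} (f : El r → Bool) → tabulate f ≡ ⟨ tabulate (f ∘ xe {r}) , tabulate (f ∘ ye {r}) , f (te {r}) ⟩
  tabulate-⟨⟩ {r} f = trans (tabulate-++ (r + r) f) (cong (_++ f (te {r}) ∷ []) (tabulate-++ r (f ∘ (_↑ˡ 1))))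

  ⟨⟩-ext : ∀ {r} {S : Subset (r + r + 1)} {X Y : Subset r} {t : Bool} →
           (∀ i → lookup S (xe {r} i) ≡ lookup X i) → (∀ i → lookup S (ye {r} i) ≡ lookup Y i) → lookup S (te {r}) ≡ t →
           S ≡ ⟨ X , Y , t ⟩
  ⟨⟩-ext {r} {S} {X} {Y} Sx Sy St = begin
    S                   ≡⟨ tabulate∘lookup S ⟨
    tabulate (lookup S) ≡⟨ tabulate-⟨⟩ {r} (lookup S) ⟩
    ⟨ tabulate (lookup S ∘ xe {r}) , tabulate (lookup S ∘ ye {r}) , lookup S (te {r}) ⟩
      ≡⟨ ⟨⟩-cong (trans (tabulate-cong Sx) (tabulate∘lookup X)) (trans (tabulate-cong Sy) (tabulate∘lookup Y)) St ⟩
    ⟨ X , Y , _ ⟩       ∎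
    where open ≡-Reasoning

  ⁅xe⁆≡⟨⁅i⁆,⊥,false⟩ : ∀ {r} (i : Fin r) → ⁅ xe {r} i ⁆ ≡ ⟨ ⁅ i ⁆ , ⊥ , false ⟩
  ⁅xe⁆≡⟨⁅i⁆,⊥,false⟩ {r} i = trans (⁅x↑ˡ⁆≡⁅x⁆++⊥ (i ↑ˡ r)) (cong (_++ ⊥) (⁅x↑ˡ⁆≡⁅x⁆++⊥ i))

  ⁅ye⁆≡⟨⊥,⁅i⁆,false⟩ : ∀ {r} (i : Fin r) → ⁅ ye {r} i ⁆ ≡ ⟨ ⊥ , ⁅ i ⁆ , false ⟩
  ⁅ye⁆≡⟨⊥,⁅i⁆,false⟩ {r} i = trans (⁅x↑ˡ⁆≡⁅x⁆++⊥ (r ↑ʳ i)) (cong (_++ ⊥) (⁅↑ʳx⁆≡⊥++⁅x⁆ r i))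

  ⁅te⁆≡⟨⊥,⊥,true⟩ : ∀ {r} → ⁅ te {r} ⁆ ≡ ⟨ ⊥ {r} , ⊥ , true ⟩
  ⁅te⁆≡⟨⊥,⊥,true⟩ {r} = trans (⁅↑ʳx⁆≡⊥++⁅x⁆ (r + r) zero) (cong (_++ true ∷ []) (⊥-++ r {r}))

  sumOver-⟨⟩ : ∀ {r} (X Y : Subset r) t (f : El r → Bool) →
               sumOver ⟨ X , Y , t ⟩ f ≡
               (sumOver X (f ∘ xe {r}) xor sumOver Y (f ∘ ye {r})) xor ((t ∧ f (te {r})) xor false)
  sumOver-⟨⟩ X Y t f = trans (sumOver-++ (X ++ Y) (t ∷ []) f) (cong (_xor _) (sumOver-++ X Y (f ∘ (_↑ˡ 1))))

-- Lets `rewrite` reach the local function that Yset and transversal are tabulated from.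
lookup-tabulated : ∀ {A : Set} {f : Fin n → A} (v : Vec A n) → v ≡ tabulate f → ∀ i → lookup v i ≡ f i
lookup-tabulated {f = f} _ refl = lookup∘tabulate f

module _ {r : ℕ} where

  pair≡⟨⁅i⁆,⁅i⁆,false⟩ : (i : Fin r) → pair i ≡ ⟨ ⁅ i ⁆ , ⁅ i ⁆ , false ⟩
  pair≡⟨⁅i⁆,⁅i⁆,false⟩ i = begin
    ⁅ xe {r} i ⁆ ∪ ⁅ ye {r} i ⁆                   ≡⟨ cong₂ _∪_ (⁅xe⁆≡⟨⁅i⁆,⊥,false⟩ i) (⁅ye⁆≡⟨⊥,⁅i⁆,false⟩ i) ⟩
    ⟨ ⁅ i ⁆ , ⊥ , false ⟩ ∪ ⟨ ⊥ , ⁅ i ⁆ , false ⟩ ≡⟨ ⟨⟩-zipWith _∨_ ⟩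
    ⟨ ⁅ i ⁆ ∪ ⊥ , ⊥ ∪ ⁅ i ⁆ , false ⟩             ≡⟨ ⟨⟩-cong (∪-identityʳ ⁅ i ⁆) (∪-identityˡ ⁅ i ⁆) refl ⟩
    ⟨ ⁅ i ⁆ , ⁅ i ⁆ , false ⟩                     ∎
    where open ≡-Reasoning

  leg≡⟨⁅i⁆,⁅i⁆,true⟩ : (i : Fin r) → leg i ≡ ⟨ ⁅ i ⁆ , ⁅ i ⁆ , true ⟩
  leg≡⟨⁅i⁆,⁅i⁆,true⟩ i = begin
    ⁅ te {r} ⁆ ∪ pair i                              ≡⟨ cong₂ _∪_ ⁅te⁆≡⟨⊥,⊥,true⟩ (pair≡⟨⁅i⁆,⁅i⁆,false⟩ i) ⟩
    ⟨ ⊥ {r} , ⊥ , true ⟩ ∪ ⟨ ⁅ i ⁆ , ⁅ i ⁆ , false ⟩ ≡⟨ ⟨⟩-zipWith _∨_ ⟩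
    ⟨ ⊥ ∪ ⁅ i ⁆ , ⊥ ∪ ⁅ i ⁆ , true ⟩                 ≡⟨ ⟨⟩-cong (∪-identityˡ ⁅ i ⁆) (∪-identityˡ ⁅ i ⁆) refl ⟩
    ⟨ ⁅ i ⁆ , ⁅ i ⁆ , true ⟩                         ∎
    where open ≡-Reasoning

  Yset≡⟨⊥,⊤,false⟩ : Yset r ≡ ⟨ ⊥ {r} , ⊤ , false ⟩
  Yset≡⟨⊥,⊤,false⟩ = ⟨⟩-ext Yset-x Yset-y Yset-t
    where
    Yset-x : (i : Fin r) → lookup (Yset r) (xe {r} i) ≡ lookup ⊥ i
    Yset-x i rewrite lookup-tabulated (Yset r) refl (xe {r} i) | splitAt-↑ˡ (r + r) (i ↑ˡ r) 1 | splitAt-↑ˡ r i r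
      = sym (lookup-replicate i false)
    Yset-y : (i : Fin r) → lookup (Yset r) (ye {r} i) ≡ lookup ⊤ i
    Yset-y i rewrite lookup-tabulated (Yset r) refl (ye {r} i) | splitAt-↑ˡ (r + r) (r ↑ʳ i) 1 | splitAt-↑ʳ r r i
      = sym (lookup-replicate i true)
    Yset-t : lookup (Yset r) (te {r}) ≡ false
    Yset-t rewrite lookup-tabulated (Yset r) refl (te {r}) | splitAt-↑ʳ (r + r) 1 zero = refl

  transversal≡⟨∁b,b,false⟩ : (b : Fin r → Bool) → transversal b ≡ ⟨ ∁ (tabulate b) , tabulate b , false ⟩
  transversal≡⟨∁b,b,false⟩ b = ⟨⟩-ext transversal-x transversal-y transversal-t
    where
    transversal-x : (i : Fin r) → lookup (transversal b) (xe {r} i) ≡ lookup (∁ (tabulate b)) i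
    transversal-x i rewrite lookup-tabulated (transversal b) refl (xe {r} i) | splitAt-↑ˡ (r + r) (i ↑ˡ r) 1
                          | splitAt-↑ˡ r i r | lookup-map i not (tabulate b) | lookup∘tabulate b i = refl
    transversal-y : (i : Fin r) → lookup (transversal b) (ye {r} i) ≡ lookup (tabulate b) i
    transversal-y i rewrite lookup-tabulated (transversal b) refl (ye {r} i) | splitAt-↑ˡ (r + r) (r ↑ʳ i) 1
                          | splitAt-↑ʳ r r i | lookup∘tabulate b i = refl
    transversal-t : lookup (transversal b) (te {r}) ≡ false
    transversal-t rewrite lookup-tabulated (transversal b) refl (te {r}) | splitAt-↑ʳ (r + r) 1 zero = refl

  Zmat-xe : ∀ k (i : Fin r) → Zmat r k (xe {r} i) ≡ does (k ≟ᶠ i)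
  Zmat-xe k i rewrite splitAt-↑ˡ (r + r) (i ↑ˡ r) 1 | splitAt-↑ˡ r i r = refl

  Zmat-ye : ∀ k (i : Fin r) → Zmat r k (ye {r} i) ≡ not (does (k ≟ᶠ i))
  Zmat-ye k i rewrite splitAt-↑ˡ (r + r) (r ↑ʳ i) 1 | splitAt-↑ʳ r r i = refl

  Zmat-te : ∀ k → Zmat r k (te {r}) ≡ true
  Zmat-te k rewrite splitAt-↑ʳ (r + r) 1 zero = refl

-- The cycles of Z_r

module _ {r : ℕ} where

  pairCycle : Subset r → Subset (r + r + 1)
  pairCycle Z = ⟨ Z , Z , parity Z ⟩

  transversalCycle : Subset r → Subset (r + r + 1)
  transversalCycle Y = ⟨ ∁ Y , Y , not (parity Y) ⟩

  sumOver-Zmat : ∀ (X Y : Subset r) t k →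
                 sumOver ⟨ X , Y , t ⟩ (Zmat r k) ≡ (lookup X k xor lookup Y k) xor (parity Y xor t)
  sumOver-Zmat X Y t k = begin
    sumOver ⟨ X , Y , t ⟩ (Zmat r k)
      ≡⟨ sumOver-⟨⟩ X Y t (Zmat r k) ⟩
    (sumOver X (Zmat r k ∘ xe) xor sumOver Y (Zmat r k ∘ ye)) xor ((t ∧ Zmat r k (te {r})) xor false)
      ≡⟨ cong₂ _xor_ (cong₂ _xor_ x-part y-part) t-part ⟩
    (lookup X k xor (parity Y xor lookup Y k)) xor t
      ≡⟨ cong (λ b → (lookup X k xor b) xor t) (xor-comm (parity Y) (lookup Y k)) ⟩
    (lookup X k xor (lookup Y k xor parity Y)) xor t
      ≡⟨ cong (_xor t) (xor-assoc (lookup X k) (lookup Y k) (parity Y)) ⟨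
    ((lookup X k xor lookup Y k) xor parity Y) xor t
      ≡⟨ xor-assoc (lookup X k xor lookup Y k) (parity Y) t ⟩
    (lookup X k xor lookup Y k) xor (parity Y xor t) ∎
    where
    open ≡-Reasoning
    x-part : sumOver X (Zmat r k ∘ xe) ≡ lookup X k
    x-part = trans (sumOver-cong X (Zmat-xe k)) (sumOver-indicator X k)
    y-part : sumOver Y (Zmat r k ∘ ye) ≡ parity Y xor lookup Y k
    y-part = trans (sumOver-cong Y (Zmat-ye k))
                   (trans (sumOver-xor Y _ _) (cong (parity Y xor_) (sumOver-indicator Y k)))
    t-part : (t ∧ Zmat r k (te {r})) xor false ≡ t
    t-part = trans (xor-identityʳ _) (trans (cong (t ∧_) (Zmat-te k)) (∧-identityʳ t))

  pairCycle-zeroSum : (Z : Subset r) → ZeroSum (Zmat r) (pairCycle Z)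
  pairCycle-zeroSum Z k =
    trans (sumOver-Zmat Z Z (parity Z) k) (cong₂ _xor_ (xor-same (lookup Z k)) (xor-same (parity Z)))

  transversalCycle-zeroSum : (Y : Subset r) → ZeroSum (Zmat r) (transversalCycle Y)
  transversalCycle-zeroSum Y k = trans (sumOver-Zmat (∁ Y) Y _ k)
    (cong₂ _xor_ (trans (cong (_xor lookup Y k) (lookup-map k not Y)) (xor-inverseˡ (lookup Y k)))
                 (xor-inverseʳ (parity Y)))

module _ (r : ℕ) where

  PairCycle TransversalCycle Cycle : Subset (r + r + 1) → Set
  PairCycle S = ∃[ Z ] S ≡ pairCycle {r} Z
  TransversalCycle S = ∃[ Y ] S ≡ transversalCycle {r} Y
  Cycle S = PairCycle S ⊎ TransversalCycle S

module _ {r : ℕ} where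

  zeroSum⇒cycle : (S : Subset (r + r + 1)) → ZeroSum (Zmat r) S → Cycle r S
  zeroSum⇒cycle S zs with coordinatesOf {r} S
  ... | coordinates X Y t = classify (parity Y xor t) refl
    where
    rows : ∀ k → lookup X k xor lookup Y k ≡ parity Y xor t
    rows k = xor≡false⇒≡ (trans (sym (sumOver-Zmat X Y t k)) (zs k))
    classify : ∀ c → parity Y xor t ≡ c → Cycle r ⟨ X , Y , t ⟩
    classify false eq = inj₁ (Y , ⟨⟩-cong X≡Y refl (sym (xor≡false⇒≡ eq)))
      where
      X≡Y : X ≡ Y
      X≡Y = Pointwise-≡⇒≡ (ext λ k → xor≡false⇒≡ (trans (rows k) eq))
    classify true eq = inj₂ (Y , ⟨⟩-cong X≡∁Y refl (xor≡true⇒≡not (trans (xor-comm t (parity Y)) eq)))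
      where
      X≡∁Y : X ≡ ∁ Y
      X≡∁Y = Pointwise-≡⇒≡ (ext λ k → trans (xor≡true⇒≡not (trans (rows k) eq)) (sym (lookup-map k not Y)))

-- The circuits of Z_r

module _ {r : ℕ} {s t : Bool} where

  ⟨Z,Z⟩⊆⟨∁Y,Y⟩⇒Z≡⊥ : {Y Z : Subset r} → ⟨ Z , Z , s ⟩ ⊆ ⟨ ∁ Y , Y , t ⟩ → Z ≡ ⊥
  ⟨Z,Z⟩⊆⟨∁Y,Y⟩⇒Z≡⊥ S⊆S′ = let Z⊆∁Y , Z⊆Y , _ = to ⟨⟩-⊆ S⊆S′ in
    Empty-unique λ (x , x∈Z) → x∈p⇒x∉∁p (Z⊆Y x∈Z) (Z⊆∁Y x∈Z)

  ⟨∁Y′,Y′⟩⊆⟨∁Y,Y⟩⇒Y′≡Y : {Y Y′ : Subset r} → ⟨ ∁ Y′ , Y′ , s ⟩ ⊆ ⟨ ∁ Y , Y , t ⟩ → Y′ ≡ Y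
  ⟨∁Y′,Y′⟩⊆⟨∁Y,Y⟩⇒Y′≡Y S⊆S′ = let ∁Y′⊆∁Y , Y′⊆Y , _ = to ⟨⟩-⊆ S⊆S′ in ⊆-antisym Y′⊆Y (∁p⊆∁q⇒p⊇q ∁Y′⊆∁Y)

  ⟨∁Y,Y⟩⊆⟨Z,Z⟩⇒Z≡⊤ : {Y Z : Subset r} → ⟨ ∁ Y , Y , s ⟩ ⊆ ⟨ Z , Z , t ⟩ → Z ≡ ⊤
  ⟨∁Y,Y⟩⊆⟨Z,Z⟩⇒Z≡⊤ {Y} {Z} S⊆S′ = let ∁Y⊆Z , Y⊆Z , _ = to ⟨⟩-⊆ S⊆S′ in
    ⊆-antisym ⊆⊤ (subst (_⊆ Z) (p∪∁p≡⊤ Y) (∪-⊆ Y⊆Z ∁Y⊆Z))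

module _ {r : ℕ} where

  pairCycle-⊥ : pairCycle (⊥ {r}) ≡ ⊥
  pairCycle-⊥ = trans (⟨⟩-cong refl refl (sumOver-⊥ {r} _)) (sym ⊥≡⟨⊥,⊥,false⟩)

  pairCycle≢⊥ : {Z : Subset r} → Z ≢ ⊥ → pairCycle Z ≢ ⊥
  pairCycle≢⊥ Z≢⊥ eq = Z≢⊥ (let Z≡⊥ , _ = ⟨⟩-injective (trans eq ⊥≡⟨⊥,⊥,false⟩) in Z≡⊥)

  transversalCycle≢⊥ : Fin r → {Y : Subset r} → transversalCycle Y ≢ ⊥
  transversalCycle≢⊥ i eq = let ∁Y≡⊥ , Y≡⊥ , _ = ⟨⟩-injective (trans eq ⊥≡⟨⊥,⊥,false⟩) in
    ∉⊥ (subst (i ∈_) ∁Y≡⊥ (x∉p⇒x∈∁p (∉⊥ ∘ subst (i ∈_) Y≡⊥)))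

  leg≡pairCycle : (i : Fin r) → leg i ≡ pairCycle ⁅ i ⁆
  leg≡pairCycle i = trans (leg≡⟨⁅i⁆,⁅i⁆,true⟩ i) (⟨⟩-cong refl refl (sym (parity-⁅⁆ i)))

  pair∪pair≡⟨U,U,false⟩ : (i j : Fin r) → pair i ∪ pair j ≡ ⟨ ⁅ i ⁆ ∪ ⁅ j ⁆ , ⁅ i ⁆ ∪ ⁅ j ⁆ , false ⟩
  pair∪pair≡⟨U,U,false⟩ i j = trans (cong₂ _∪_ (pair≡⟨⁅i⁆,⁅i⁆,false⟩ i) (pair≡⟨⁅i⁆,⁅i⁆,false⟩ j)) (⟨⟩-zipWith _∨_)

  pair∪pair≡pairCycle : {i j : Fin r} → i ≢ j → pair i ∪ pair j ≡ pairCycle (⁅ i ⁆ ∪ ⁅ j ⁆)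
  pair∪pair≡pairCycle {i} {j} i≢j =
    trans (pair∪pair≡⟨U,U,false⟩ i j) (⟨⟩-cong refl refl (sym (parity-⁅x⁆∪⁅y⁆ i≢j)))

  pair∪pair∈φ₂ : {i j : Fin r} → i ≢ j → φ₂ r (pair i ∪ pair j)
  pair∪pair∈φ₂ {i} {j} i≢j with <-cmp i j
  ... | tri< i<j _ _ = i , j , i<j , refl
  ... | tri≈ _ i≡j _ = ⊥-elim (i≢j i≡j)
  ... | tri> _ _ j<i = j , i , j<i , ∪-comm (pair i) (pair j)

module _ {r : ℕ} (2<r : 2 < r) where

  pairCycle-circuit : {Z : Subset r} → Z ≢ ⊥ → ∣ Z ∣ ≤ 2 → VecCircuit (Zmat r) (pairCycle Z)
  pairCycle-circuit {Z} Z≢⊥ ∣Z∣≤2 =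
    circuit-intro (Zmat r) (from Nonempty⇔≢⊥ (pairCycle≢⊥ Z≢⊥)) (pairCycle-zeroSum Z) minimal
    where
    minimal : ∀ D → D ⊆ pairCycle Z → Nonempty D → ZeroSum (Zmat r) D → D ≡ pairCycle Z
    minimal D D⊆ neD zsD with zeroSum⇒cycle D zsD
    ... | inj₁ (Z′ , refl) = let Z′⊆Z , _ , t⊆ = to ⟨⟩-⊆ D⊆ in
      cong pairCycle (parity-minimal ∣Z∣≤2 Z′⊆Z Z′≢⊥ t⊆)
      where
      Z′≢⊥ : Z′ ≢ ⊥
      Z′≢⊥ refl = to Nonempty⇔≢⊥ neD pairCycle-⊥
    ... | inj₂ (Y , refl) =
      ⊥-elim (<⇒≱ 2<r (subst (_≤ 2) (trans (cong ∣_∣ (⟨∁Y,Y⟩⊆⟨Z,Z⟩⇒Z≡⊤ D⊆)) (∣⊤∣≡n r)) ∣Z∣≤2))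

  transversalCycle-circuit : (Y : Subset r) → VecCircuit (Zmat r) (transversalCycle Y)
  transversalCycle-circuit Y =
    circuit-intro (Zmat r) (from Nonempty⇔≢⊥ (transversalCycle≢⊥ (fromℕ< (m<n⇒0<n 2<r))))
                  (transversalCycle-zeroSum Y) minimal
    where
    minimal : ∀ D → D ⊆ transversalCycle Y → Nonempty D → ZeroSum (Zmat r) D → D ≡ transversalCycle Y
    minimal D D⊆ neD zsD with zeroSum⇒cycle D zsD
    ... | inj₁ (Z , refl) =
      ⊥-elim (to Nonempty⇔≢⊥ neD (trans (cong pairCycle (⟨Z,Z⟩⊆⟨∁Y,Y⟩⇒Z≡⊥ D⊆)) pairCycle-⊥))
    ... | inj₂ (Y′ , refl) = cong transversalCycle (⟨∁Y′,Y′⟩⊆⟨∁Y,Y⟩⇒Y′≡Y D⊆)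

  VecCircuit⇒φ₁⊎φ₂⊎TransversalCycle : (S : Subset (r + r + 1)) → VecCircuit (Zmat r) S →
                                       φ₁ r S ⊎ φ₂ r S ⊎ TransversalCycle r S
  VecCircuit⇒φ₁⊎φ₂⊎TransversalCycle S circuit with zeroSum⇒cycle S (proj₁ (proj₂ circuit))
  ... | inj₂ transversal = inj₂ (inj₂ transversal)
  ... | inj₁ (Z , refl)
    with from Nonempty⇔≢⊥ (λ Z≡⊥ → to Nonempty⇔≢⊥ (proj₁ circuit) (trans (cong pairCycle Z≡⊥) pairCycle-⊥))
  ...   | i , i∈Z = by-parity (parity Z) refl
    where
    minimal : ∀ {Z′} → Z′ ⊆ Z → (T (parity Z′) → T (parity Z)) → Nonempty Z′ → pairCycle Z′ ≡ pairCycle Z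
    minimal Z′⊆Z parity⇒ (_ , x∈Z′) = circuit-minimal (Zmat r) circuit (from ⟨⟩-⊆ (Z′⊆Z , Z′⊆Z , parity⇒))
      (from Nonempty⇔≢⊥ (pairCycle≢⊥ (x∈p⇒p≢⊥ x∈Z′))) (pairCycle-zeroSum _)
    by-parity : ∀ b → parity Z ≡ b →
                φ₁ r (pairCycle Z) ⊎ φ₂ r (pairCycle Z) ⊎ TransversalCycle r (pairCycle Z)
    by-parity true parity-Z = inj₁ (i , trans (sym leg-minimal) (sym (leg≡pairCycle i)))
      where
      leg-minimal : pairCycle ⁅ i ⁆ ≡ pairCycle Z
      leg-minimal = minimal (⁅x⁆⊆p i∈Z) (λ _ → subst T (sym parity-Z) _) (i , x∈⁅x⁆ i)
    by-parity false parity-Z = inj₂ (inj₁ (two-pairs (⊆∧≢⇒⊂ (⁅x⁆⊆p i∈Z) ⁅i⁆≢Z)))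
      where
      ⁅i⁆≢Z : ⁅ i ⁆ ≢ Z
      ⁅i⁆≢Z ⁅i⁆≡Z = true≢false (trans (sym (parity-⁅⁆ i)) (trans (cong parity ⁅i⁆≡Z) parity-Z))
      two-pairs : ⁅ i ⁆ ⊂ Z → φ₂ r (pairCycle Z)
      two-pairs (_ , j , j∈Z , j∉⁅i⁆) = subst (φ₂ r) pairs-minimal (pair∪pair∈φ₂ i≢j)
        where
        i≢j : i ≢ j
        i≢j = x∉⁅y⁆⇒x≢y j∉⁅i⁆ ∘ sym
        pairs-minimal : pair i ∪ pair j ≡ pairCycle Z
        pairs-minimal = trans (pair∪pair≡pairCycle i≢j)
          (minimal (∪-⊆ (⁅x⁆⊆p i∈Z) (⁅x⁆⊆p j∈Z)) (⊥-elim ∘ subst T (parity-⁅x⁆∪⁅y⁆ i≢j))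
                   (i , p⊆p∪q ⁅ j ⁆ (x∈⁅x⁆ i)))

  φ₁⊎φ₂⊎TransversalCycle⇒VecCircuit : (S : Subset (r + r + 1)) →
                                   φ₁ r S ⊎ φ₂ r S ⊎ TransversalCycle r S → VecCircuit (Zmat r) S
  φ₁⊎φ₂⊎TransversalCycle⇒VecCircuit _ (inj₁ (i , refl)) =
    subst (VecCircuit (Zmat r)) (sym (leg≡pairCycle i))
      (pairCycle-circuit (x∈p⇒p≢⊥ (x∈⁅x⁆ i)) (subst (_≤ 2) (sym (∣⁅x⁆∣≡1 i)) (s≤s z≤n)))
  φ₁⊎φ₂⊎TransversalCycle⇒VecCircuit _ (inj₂ (inj₁ (i , j , i<j , refl))) =
    subst (VecCircuit (Zmat r)) (sym (pair∪pair≡pairCycle i≢j))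
      (pairCycle-circuit (x∈p⇒p≢⊥ (p⊆p∪q ⁅ j ⁆ (x∈⁅x⁆ i))) (≤-reflexive (∣⁅x⁆∪⁅y⁆∣≡2 i≢j)))
    where
    i≢j : i ≢ j
    i≢j = <⇒≢ i<j
  φ₁⊎φ₂⊎TransversalCycle⇒VecCircuit _ (inj₂ (inj₂ (Y , refl))) = transversalCycle-circuit Y

  VecCircuit⇔φ₁⊎φ₂⊎TransversalCycle : (S : Subset (r + r + 1)) →
                                   VecCircuit (Zmat r) S ⇔ (φ₁ r S ⊎ φ₂ r S ⊎ TransversalCycle r S)
  VecCircuit⇔φ₁⊎φ₂⊎TransversalCycle S =
    mk⇔ (VecCircuit⇒φ₁⊎φ₂⊎TransversalCycle S) (φ₁⊎φ₂⊎TransversalCycle⇒VecCircuit S)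

-- The families φ₃, φ₄ and 𝒞₄

module _ (r : ℕ) where

  OddTransversal EvenTransversalWithTip : Subset (r + r + 1) → Set
  OddTransversal S = ∃ λ (Y : Subset r) → parity Y ≡ true × S ≡ ⟨ ∁ Y , Y , false ⟩
  EvenTransversalWithTip S = ∃ λ (Y : Subset r) → parity Y ≡ false × S ≡ ⟨ ∁ Y , Y , true ⟩

module _ {r : ℕ} where

  ∣⟨⟩∩pair∣ : {X Y : Subset r} {t : Bool} (i : Fin r) →
              ∣ ⟨ X , Y , t ⟩ ∩ pair i ∣ ≡ ∣ lookup X i ∷ [] ∣ + ∣ lookup Y i ∷ [] ∣
  ∣⟨⟩∩pair∣ {X} {Y} {t} i = begin
    ∣ ⟨ X , Y , t ⟩ ∩ pair i ∣                         ≡⟨ cong (λ P → ∣ ⟨ X , Y , t ⟩ ∩ P ∣) (pair≡⟨⁅i⁆,⁅i⁆,false⟩ i) ⟩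
    ∣ ⟨ X , Y , t ⟩ ∩ ⟨ ⁅ i ⁆ , ⁅ i ⁆ , false ⟩ ∣      ≡⟨ cong ∣_∣ (⟨⟩-zipWith _∧_) ⟩
    ∣ ⟨ X ∩ ⁅ i ⁆ , Y ∩ ⁅ i ⁆ , t ∧ false ⟩ ∣          ≡⟨ ∣⟨⟩∣ ⟩
    ∣ X ∩ ⁅ i ⁆ ∣ + ∣ Y ∩ ⁅ i ⁆ ∣ + ∣ t ∧ false ∷ [] ∣
      ≡⟨ cong₂ _+_ (cong₂ _+_ (∣p∩⁅x⁆∣≡∣[p[x]]∣ X i) (∣p∩⁅x⁆∣≡∣[p[x]]∣ Y i)) (cong (λ b → ∣ b ∷ [] ∣) (∧-zeroʳ t)) ⟩
    ∣ lookup X i ∷ [] ∣ + ∣ lookup Y i ∷ [] ∣ + 0       ≡⟨ +-identityʳ _ ⟩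
    ∣ lookup X i ∷ [] ∣ + ∣ lookup Y i ∷ [] ∣           ∎
    where open ≡-Reasoning

  ∣⟨⟩∩Yset∣ : {X Y : Subset r} {t : Bool} → ∣ ⟨ X , Y , t ⟩ ∩ Yset r ∣ ≡ ∣ Y ∣
  ∣⟨⟩∩Yset∣ {X} {Y} {t} = begin
    ∣ ⟨ X , Y , t ⟩ ∩ Yset r ∣                ≡⟨ cong (λ P → ∣ ⟨ X , Y , t ⟩ ∩ P ∣) Yset≡⟨⊥,⊤,false⟩ ⟩
    ∣ ⟨ X , Y , t ⟩ ∩ ⟨ ⊥ {r} , ⊤ , false ⟩ ∣ ≡⟨ cong ∣_∣ (⟨⟩-zipWith _∧_) ⟩
    ∣ ⟨ X ∩ ⊥ , Y ∩ ⊤ , t ∧ false ⟩ ∣         ≡⟨ cong ∣_∣ (⟨⟩-cong (∩-zeroʳ X) (∩-identityʳ Y) (∧-zeroʳ t)) ⟩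
    ∣ ⟨ ⊥ , Y , false ⟩ ∣                     ≡⟨ ∣⟨⟩∣ ⟩
    ∣ ⊥ {r} ∣ + ∣ Y ∣ + 0                     ≡⟨ cong (λ k → k + ∣ Y ∣ + 0) (∣⊥∣≡0 r) ⟩
    ∣ Y ∣ + 0                                 ≡⟨ +-identityʳ _ ⟩
    ∣ Y ∣                                     ∎
    where open ≡-Reasoning


  φ₃⇒OddTransversal : (S : Subset (r + r + 1)) → φ₃ r S → OddTransversal r S
  φ₃⇒OddTransversal S (size , odd , pairs) with coordinatesOf {r} S
  ... | coordinates X Y t =
    Y , parity-from-∣∣ Y (trans (cong (_% 2) (sym ∣⟨⟩∩Yset∣)) odd) , ⟨⟩-cong X≡∁Y refl t≡false
    where
    one-of-pair : ∀ {a b} → ∣ a ∷ [] ∣ + ∣ b ∷ [] ∣ ≡ 1 → a ≡ not b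
    one-of-pair {true}  {false} _ = refl
    one-of-pair {false} {true}  _ = refl
    X≡∁Y : X ≡ ∁ Y
    X≡∁Y = Pointwise-≡⇒≡ (ext λ i →
      trans (one-of-pair (trans (sym (∣⟨⟩∩pair∣ i)) (pairs i))) (sym (lookup-map i not Y)))
    ∣X∣+∣Y∣≡r : ∣ X ∣ + ∣ Y ∣ ≡ r
    ∣X∣+∣Y∣≡r = trans (cong (λ Z → ∣ Z ∣ + ∣ Y ∣) X≡∁Y) (∣∁p∣+∣p∣≡n Y)
    t≡false : t ≡ false
    t≡false = empty-bit (+-cancelˡ-≡ r _ _ (begin
      r + ∣ t ∷ [] ∣             ≡⟨ cong (_+ ∣ t ∷ [] ∣) ∣X∣+∣Y∣≡r ⟨
      ∣ X ∣ + ∣ Y ∣ + ∣ t ∷ [] ∣ ≡⟨ ∣⟨⟩∣ ⟨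
      ∣ ⟨ X , Y , t ⟩ ∣          ≡⟨ trans size (+-comm 0 r) ⟩
      r + 0                      ∎))
      where
      open ≡-Reasoning
      empty-bit : ∀ {b} → ∣ b ∷ [] ∣ ≡ 0 → b ≡ false
      empty-bit {false} _ = refl

  OddTransversal⇒φ₃ : (S : Subset (r + r + 1)) → OddTransversal r S → φ₃ r S
  OddTransversal⇒φ₃ _ (Y , parity-Y , refl) = size , odd , pairs
    where
    size : ∣ ⟨ ∁ Y , Y , false ⟩ ∣ ≡ r
    size = trans ∣⟨⟩∣ (trans (+-identityʳ _) (∣∁p∣+∣p∣≡n Y))
    odd : ∣ ⟨ ∁ Y , Y , false ⟩ ∩ Yset r ∣ % 2 ≡ 1
    odd = trans (cong (_% 2) ∣⟨⟩∩Yset∣) (trans (∣p∣%2≡parity Y) (cong (if_then 1 else 0) parity-Y))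
    one : ∀ b → ∣ not b ∷ [] ∣ + ∣ b ∷ [] ∣ ≡ 1
    one true  = refl
    one false = refl
    pairs : ∀ i → ∣ ⟨ ∁ Y , Y , false ⟩ ∩ pair i ∣ ≡ 1
    pairs i = trans (∣⟨⟩∩pair∣ i)
                    (trans (cong (λ b → ∣ b ∷ [] ∣ + ∣ lookup Y i ∷ [] ∣) (lookup-map i not Y)) (one (lookup Y i)))

  r%2≡parity⊤ : r % 2 ≡ (if parity (⊤ {r}) then 1 else 0)
  r%2≡parity⊤ = trans (cong (_% 2) (sym (∣⊤∣≡n r))) (∣p∣%2≡parity (⊤ {r}))

  parity-Δ⁅⁆ : (Y : Subset r) (j : Fin r) → parity (Y Δ ⁅ j ⁆) ≡ not (parity Y)
  parity-Δ⁅⁆ Y j = trans (parity-Δ Y ⁅ j ⁆) (trans (cong (parity Y xor_) (parity-⁅⁆ j)) (xor-comm (parity Y) true))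

  ⟨∁Y,Y⟩Δpair : {Y : Subset r} {t : Bool} (j : Fin r) → ⟨ ∁ Y , Y , t ⟩ Δ pair j ≡ ⟨ ∁ (Y Δ ⁅ j ⁆) , Y Δ ⁅ j ⁆ , t ⟩
  ⟨∁Y,Y⟩Δpair {Y} {t} j = begin
    ⟨ ∁ Y , Y , t ⟩ Δ pair j                       ≡⟨ cong (⟨ ∁ Y , Y , t ⟩ Δ_) (pair≡⟨⁅i⁆,⁅i⁆,false⟩ j) ⟩
    ⟨ ∁ Y , Y , t ⟩ Δ ⟨ ⁅ j ⁆ , ⁅ j ⁆ , false ⟩      ≡⟨ ⟨⟩-zipWith _xor_ ⟩
    ⟨ ∁ Y Δ ⁅ j ⁆ , Y Δ ⁅ j ⁆ , t xor false ⟩       ≡⟨ ⟨⟩-cong (sym (∁-Δ Y ⁅ j ⁆)) refl (xor-identityʳ t) ⟩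
    ⟨ ∁ (Y Δ ⁅ j ⁆) , Y Δ ⁅ j ⁆ , t ⟩               ∎
    where open ≡-Reasoning

  φ₄⇒EvenTransversalWithTip : (S : Subset (r + r + 1)) → φ₄ r S → EvenTransversalWithTip r S
  φ₄⇒EvenTransversalWithTip S (C , φ₃C , shape) with φ₃⇒OddTransversal C φ₃C
  φ₄⇒EvenTransversalWithTip _ (_ , _ , inj₁ (odd , refl)) | Y , parity-Y , refl =
    ∁ Y , trans (parity-∁ Y) (cong₂ _xor_ parity-⊤ parity-Y) , ⟨⟩-∁
    where
    parity-⊤ : parity (⊤ {r}) ≡ true
    parity-⊤ = parity-from-∣∣ (⊤ {r}) (trans (cong (_% 2) (∣⊤∣≡n r)) odd)
  φ₄⇒EvenTransversalWithTip _ (_ , _ , inj₂ (even , j , _ , refl)) | Y , parity-Y , refl =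
    ∁ Y Δ ⁅ j ⁆ , trans (parity-Δ⁅⁆ (∁ Y) j) (cong not (trans (parity-∁ Y) (cong₂ _xor_ parity-⊤ parity-Y))) ,
    trans (cong (_Δ pair j) ⟨⟩-∁) (⟨∁Y,Y⟩Δpair j)
    where
    parity-⊤ : parity (⊤ {r}) ≡ false
    parity-⊤ = parity-from-∣∣ (⊤ {r}) (trans (cong (_% 2) (∣⊤∣≡n r)) even)

  EvenTransversalWithTip⇒φ₄ : 2 ≤ r → (S : Subset (r + r + 1)) → EvenTransversalWithTip r S → φ₄ r S
  EvenTransversalWithTip⇒φ₄ 2≤r _ (Y , parity-Y , refl) = by-parity-⊤ (parity (⊤ {r})) refl
    where
    by-parity-⊤ : ∀ b → parity (⊤ {r}) ≡ b → φ₄ r ⟨ ∁ Y , Y , true ⟩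
    by-parity-⊤ true parity-⊤ =
      ∁ ⟨ ∁ Y , Y , true ⟩ ,
      OddTransversal⇒φ₃ _ (∁ Y , trans (parity-∁ Y) (cong₂ _xor_ parity-⊤ parity-Y) , ⟨⟩-∁) ,
      inj₁ (trans r%2≡parity⊤ (cong (if_then 1 else 0) parity-⊤) , sym (∁-involutive _))
    by-parity-⊤ false parity-⊤ =
      C ,
      OddTransversal⇒φ₃ C (∁ (Y Δ ⁅ j ⁆) , parity-C , trans (cong ∁ (⟨∁Y,Y⟩Δpair j)) ⟨⟩-∁) ,
      inj₂ (trans r%2≡parity⊤ (cong (if_then 1 else 0) parity-⊤) , j , toℕ-fromℕ< r∸2<r ,
            sym (trans (cong (_Δ pair j) (∁-involutive _)) (Δ-cancelʳ _ (pair j))))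
      where
      r∸2<r : r ∸ 2 < r
      r∸2<r = ∸-monoʳ-< (s≤s z≤n) 2≤r
      j : Fin r
      j = fromℕ< r∸2<r
      C : Subset (r + r + 1)
      C = ∁ (⟨ ∁ Y , Y , true ⟩ Δ pair j)
      parity-C : parity (∁ (Y Δ ⁅ j ⁆)) ≡ true
      parity-C = trans (parity-∁ (Y Δ ⁅ j ⁆)) (cong₂ _xor_ parity-⊤ (trans (parity-Δ⁅⁆ Y j) (cong not parity-Y)))

  φ₄⇔EvenTransversalWithTip : 2 ≤ r → (S : Subset (r + r + 1)) → φ₄ r S ⇔ EvenTransversalWithTip r S
  φ₄⇔EvenTransversalWithTip 2≤r S = mk⇔ (φ₄⇒EvenTransversalWithTip S) (EvenTransversalWithTip⇒φ₄ 2≤r S)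

  odd-transversal-inside : {X Y : Subset r} {i : Fin r} → X ∪ Y ≡ ⊤ → i ∈ X → i ∈ Y →
                           ∃ λ Y′ → parity Y′ ≡ true × ∁ Y′ ⊆ X × Y′ ⊆ Y
  odd-transversal-inside {X} {Y} {i} X∪Y≡⊤ i∈X i∈Y = by-parity (parity Y) refl
    where
    by-parity : ∀ b → parity Y ≡ b → ∃ λ Y′ → parity Y′ ≡ true × ∁ Y′ ⊆ X × Y′ ⊆ Y
    by-parity true  parity-Y = Y , parity-Y , ∪≡⊤⇒∁⊆ X∪Y≡⊤ , ⊆-refl
    by-parity false parity-Y = Y Δ ⁅ i ⁆ , trans (parity-Δ⁅⁆ Y i) (cong not parity-Y) ,
      subst (_⊆ X) (sym (∁-Δ Y ⁅ i ⁆)) (⊆-trans (Δ⊆∪ (∁ Y) ⁅ i ⁆) (∪-⊆ (∪≡⊤⇒∁⊆ X∪Y≡⊤) (⁅x⁆⊆p i∈X))) ,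
      ⊆-trans (Δ⊆∪ Y ⁅ i ⁆) (∪-⊆ ⊆-refl (⁅x⁆⊆p i∈Y))

  EvenTransversalWithTip⇒𝒞₄ : (S : Subset (r + r + 1)) → EvenTransversalWithTip r S → 𝒞₄ r (φ₃ r) S
  EvenTransversalWithTip⇒𝒞₄ _ (Y , parity-Y , refl) = size , avoids
    where
    size : ∣ ⟨ ∁ Y , Y , true ⟩ ∣ ≡ suc r
    size = trans ∣⟨⟩∣ (trans (cong (_+ 1) (∣∁p∣+∣p∣≡n Y)) (+-comm r 1))
    avoids : ∀ D → D ⊆ ⟨ ∁ Y , Y , true ⟩ → ¬ (φ₁ r D ⊎ φ₂ r D ⊎ φ₃ r D)
    avoids D D⊆ (inj₁ (i , refl)) =
      x∈p⇒p≢⊥ (x∈⁅x⁆ i) (⟨Z,Z⟩⊆⟨∁Y,Y⟩⇒Z≡⊥ (subst (_⊆ _) (leg≡⟨⁅i⁆,⁅i⁆,true⟩ i) D⊆))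
    avoids D D⊆ (inj₂ (inj₁ (i , j , _ , refl))) =
      x∈p⇒p≢⊥ (p⊆p∪q ⁅ j ⁆ (x∈⁅x⁆ i)) (⟨Z,Z⟩⊆⟨∁Y,Y⟩⇒Z≡⊥ (subst (_⊆ _) (pair∪pair≡⟨U,U,false⟩ i j) D⊆))
    avoids D D⊆ (inj₂ (inj₂ φ₃D)) with φ₃⇒OddTransversal D φ₃D
    ... | Y′ , parity-Y′ , refl =
      true≢false (trans (sym parity-Y′) (trans (cong parity (⟨∁Y′,Y′⟩⊆⟨∁Y,Y⟩⇒Y′≡Y D⊆)) parity-Y))

  𝒞₄-with-tip⇒EvenTransversalWithTip : {X Y : Subset r} → 𝒞₄ r (φ₃ r) ⟨ X , Y , true ⟩ →
                                       EvenTransversalWithTip r ⟨ X , Y , true ⟩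
  𝒞₄-with-tip⇒EvenTransversalWithTip {X} {Y} (size , avoids) = Y , parity-Y , ⟨⟩-cong X≡∁Y refl refl
    where
    X∩Y≡⊥ : X ∩ Y ≡ ⊥
    X∩Y≡⊥ = Empty-unique λ (i , i∈X∩Y) → let i∈X , i∈Y = x∈p∩q⁻ X Y i∈X∩Y in
      avoids (leg i)
        (subst (_⊆ ⟨ X , Y , true ⟩) (sym (leg≡⟨⁅i⁆,⁅i⁆,true⟩ i)) (from ⟨⟩-⊆ (⁅x⁆⊆p i∈X , ⁅x⁆⊆p i∈Y , id)))
        (inj₁ (i , refl))
    ∣X∪Y∣≡r : ∣ X ∪ Y ∣ ≡ r
    ∣X∪Y∣≡r = begin
      ∣ X ∪ Y ∣                   ≡⟨ +-identityʳ _ ⟨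
      ∣ X ∪ Y ∣ + 0               ≡⟨ cong (∣ X ∪ Y ∣ +_) (trans (cong ∣_∣ X∩Y≡⊥) (∣⊥∣≡0 r)) ⟨
      ∣ X ∪ Y ∣ + ∣ X ∩ Y ∣       ≡⟨ ∣p∪q∣+∣p∩q∣≡∣p∣+∣q∣ X Y ⟩
      ∣ X ∣ + ∣ Y ∣               ≡⟨ suc-injective (trans (+-comm 1 _) (trans (sym ∣⟨⟩∣) size)) ⟩
      r                           ∎
      where open ≡-Reasoning
    X≡∁Y : X ≡ ∁ Y
    X≡∁Y = ⊆-antisym (∩≡⊥⇒⊆∁ X∩Y≡⊥) (∪≡⊤⇒∁⊆ (∣p∣≡n⇒p≡⊤ ∣X∪Y∣≡r))
    parity-Y : parity Y ≡ false
    parity-Y = ¬-not λ odd → avoids ⟨ ∁ Y , Y , false ⟩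
      (from ⟨⟩-⊆ (subst (∁ Y ⊆_) (sym X≡∁Y) ⊆-refl , ⊆-refl , λ ()))
      (inj₂ (inj₂ (OddTransversal⇒φ₃ _ (Y , odd , refl))))

  -- Without the tip, r + 1 elements spread over the r pairs {x_i, y_i} that contain no two
  -- full pairs cover every pair and fill exactly one, so they contain a transversal with an
  -- odd number of y's, i.e. a member of φ₃.
  𝒞₄-without-tip : {X Y : Subset r} → ¬ 𝒞₄ r (φ₃ r) ⟨ X , Y , false ⟩
  𝒞₄-without-tip {X} {Y} (size , avoids) = X∩Y-empty (from Nonempty⇔≢⊥ X∩Y≢⊥)
    where
    squeeze : ∀ {a b} → a + b ≡ suc r → a ≤ r → b ≤ 1 → a ≡ r × b ≡ 1
    squeeze {a} eq a≤r z≤n       = ⊥-elim (1+n≰n (subst (_≤ r) (trans (sym (+-identityʳ a)) eq) a≤r))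
    squeeze {a} eq a≤r (s≤s z≤n) = suc-injective (trans (+-comm 1 a) eq) , refl
    pair-free : ∀ {i j} → i ∈ X ∩ Y → j ∈ X ∩ Y → i ≡ j
    pair-free {i} {j} i∈X∩Y j∈X∩Y with i ≟ᶠ j
    ... | yes i≡j = i≡j
    ... | no  i≢j = ⊥-elim (avoids (pair i ∪ pair j) pairs⊆S (inj₂ (inj₁ (pair∪pair∈φ₂ i≢j))))
      where
      pairs⊆S : pair i ∪ pair j ⊆ ⟨ X , Y , false ⟩
      pairs⊆S = let i∈X , i∈Y = x∈p∩q⁻ X Y i∈X∩Y ; j∈X , j∈Y = x∈p∩q⁻ X Y j∈X∩Y in
        subst (_⊆ _) (sym (pair∪pair≡⟨U,U,false⟩ i j))
          (from ⟨⟩-⊆ (∪-⊆ (⁅x⁆⊆p i∈X) (⁅x⁆⊆p j∈X) , ∪-⊆ (⁅x⁆⊆p i∈Y) (⁅x⁆⊆p j∈Y) , id))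
    sizes : ∣ X ∪ Y ∣ ≡ r × ∣ X ∩ Y ∣ ≡ 1
    sizes = squeeze (trans (∣p∪q∣+∣p∩q∣≡∣p∣+∣q∣ X Y) (trans (sym (+-identityʳ _)) (trans (sym ∣⟨⟩∣) size)))
                    (∣p∣≤n (X ∪ Y)) (∣p∣≤1 pair-free)
    X∩Y≢⊥ : X ∩ Y ≢ ⊥
    X∩Y≢⊥ X∩Y≡⊥ with trans (sym (proj₂ sizes)) (trans (cong ∣_∣ X∩Y≡⊥) (∣⊥∣≡0 r))
    ... | ()
    X∩Y-empty : ¬ Nonempty (X ∩ Y)
    X∩Y-empty (i , i∈X∩Y)
      with odd-transversal-inside (∣p∣≡n⇒p≡⊤ (proj₁ sizes)) (proj₁ (x∈p∩q⁻ X Y i∈X∩Y)) (proj₂ (x∈p∩q⁻ X Y i∈X∩Y))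
    ... | Y′ , parity-Y′ , ∁Y′⊆X , Y′⊆Y = avoids ⟨ ∁ Y′ , Y′ , false ⟩ (from ⟨⟩-⊆ (∁Y′⊆X , Y′⊆Y , id))
                                            (inj₂ (inj₂ (OddTransversal⇒φ₃ _ (Y′ , parity-Y′ , refl))))

  𝒞₄⇔EvenTransversalWithTip : (S : Subset (r + r + 1)) → 𝒞₄ r (φ₃ r) S ⇔ EvenTransversalWithTip r S
  𝒞₄⇔EvenTransversalWithTip S = mk⇔ (𝒞₄⇒ S) (EvenTransversalWithTip⇒𝒞₄ S)
    where
    𝒞₄⇒ : ∀ S → 𝒞₄ r (φ₃ r) S → EvenTransversalWithTip r S
    𝒞₄⇒ S c₄ with coordinatesOf {r} S
    ... | coordinates X Y true  = 𝒞₄-with-tip⇒EvenTransversalWithTip c₄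
    ... | coordinates X Y false = ⊥-elim (𝒞₄-without-tip c₄)

-- Z_r as a binary spike

module _ {r : ℕ} where

  φ₃⇒Transversal : ∀ Z → φ₃ r Z → Transversal r Z
  φ₃⇒Transversal Z φ₃Z with φ₃⇒OddTransversal Z φ₃Z
  ... | Y , _ , refl = lookup Y ,
    sym (trans (transversal≡⟨∁b,b,false⟩ (lookup Y)) (⟨⟩-cong (cong ∁ (tabulate∘lookup Y)) (tabulate∘lookup Y) refl))

  φ₃-intersection : ∀ Z Z′ → φ₃ r Z → φ₃ r Z′ → Z ≢ Z′ → ∣ Z ∩ Z′ ∣ ≤ r ∸ 2
  φ₃-intersection Z Z′ φ₃Z φ₃Z′ Z≢Z′ with φ₃⇒OddTransversal Z φ₃Z | φ₃⇒OddTransversal Z′ φ₃Z′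
  ... | Y , parity-Y , refl | Y′ , parity-Y′ , refl = m+n≤o⇒m≤o∸n _ (begin
    ∣ ⟨ ∁ Y , Y , false ⟩ ∩ ⟨ ∁ Y′ , Y′ , false ⟩ ∣ + 2 ≡⟨ cong (λ S → ∣ S ∣ + 2) (⟨⟩-zipWith _) ⟩
    ∣ ⟨ ∁ Y ∩ ∁ Y′ , Y ∩ Y′ , false ⟩ ∣ + 2              ≡⟨ cong (_+ 2) ∣⟨⟩∣ ⟩
    ∣ ∁ Y ∩ ∁ Y′ ∣ + ∣ Y ∩ Y′ ∣ + 0 + 2                   ≡⟨ cong (_+ 2) (+-identityʳ _) ⟩
    ∣ ∁ Y ∩ ∁ Y′ ∣ + ∣ Y ∩ Y′ ∣ + 2                       ≤⟨ +-monoʳ-≤ _ 2≤∣YΔY′∣ ⟩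
    ∣ ∁ Y ∩ ∁ Y′ ∣ + ∣ Y ∩ Y′ ∣ + ∣ Y Δ Y′ ∣              ≡⟨ ∣∁p∩∁q∣+∣p∩q∣+∣pΔq∣≡n Y Y′ ⟩
    r                                                    ∎)
    where
    open ≤-Reasoning
    2≤∣YΔY′∣ : 2 ≤ ∣ Y Δ Y′ ∣
    2≤∣YΔY′∣ = parity≡false⇒2≤∣p∣ (Z≢Z′ ∘ cong (λ Y → ⟨ ∁ Y , Y , false ⟩) ∘ Δ≡⊥⇒≡)
                                  (trans (parity-Δ Y Y′) (cong₂ _xor_ parity-Y parity-Y′))

  TransversalCycle⇔φ₃⊎φ₄ : 2 ≤ r → (S : Subset (r + r + 1)) → TransversalCycle r S ⇔ (φ₃ r S ⊎ φ₄ r S)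
  TransversalCycle⇔φ₃⊎φ₄ 2≤r S = mk⇔ to′ from′
    where
    to′ : TransversalCycle r S → φ₃ r S ⊎ φ₄ r S
    to′ (Y , refl) = by-parity (parity Y) refl
      where
      by-parity : ∀ b → parity Y ≡ b → φ₃ r (transversalCycle Y) ⊎ φ₄ r (transversalCycle Y)
      by-parity true  odd  = inj₁ (OddTransversal⇒φ₃ _ (Y , odd , ⟨⟩-cong refl refl (cong not odd)))
      by-parity false even = inj₂ (EvenTransversalWithTip⇒φ₄ 2≤r _ (Y , even , ⟨⟩-cong refl refl (cong not even)))
    from′ : φ₃ r S ⊎ φ₄ r S → TransversalCycle r S
    from′ (inj₁ φ₃S) with φ₃⇒OddTransversal S φ₃S
    ... | Y , odd , refl = Y , ⟨⟩-cong refl refl (cong not (sym odd))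
    from′ (inj₂ φ₄S) with φ₄⇒EvenTransversalWithTip S φ₄S
    ... | Y , even , refl = Y , ⟨⟩-cong refl refl (cong not (sym even))

  φ⇔VecCircuit : 3 ≤ r → (C : Subset (r + r + 1)) → φ r C ⇔ VecCircuit (Zmat r) C
  φ⇔VecCircuit 3≤r C = ⇔-sym (⇔-trans (VecCircuit⇔φ₁⊎φ₂⊎TransversalCycle 3≤r C)
                                     (⇔-refl ⊎-⇔ ⇔-refl ⊎-⇔ TransversalCycle⇔φ₃⊎φ₄ (<⇒≤ 3≤r) C))

  φ⇔spikeCircuit : 2 ≤ r → (C : Subset (r + r + 1)) →
                   φ r C ⇔ (𝒞₁ r C ⊎ 𝒞₂ r C ⊎ φ₃ r C ⊎ 𝒞₄ r (φ₃ r) C)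
  φ⇔spikeCircuit 2≤r C = ⇔-refl ⊎-⇔ ⇔-refl ⊎-⇔ ⇔-refl ⊎-⇔
                         ⇔-trans (φ₄⇔EvenTransversalWithTip 2≤r C) (⇔-sym (𝒞₄⇔EvenTransversalWithTip C))

theorem5 : (r : ℕ) → 3 ≤ r → (M : Matroid (r + r + 1)) →
           (∀ C → Circuit M C ⇔ φ r C) →
           IsBinary M × IsSpike r M × (∀ C → Circuit M C ⇔ VecCircuit (Zmat r) C)
theorem5 r 3≤r M circuits = (r , Zmat r , binary) , (φ₃ r , φ₃⇒Transversal , φ₃-intersection , spike) , binary
  where
  binary : ∀ C → Circuit M C ⇔ VecCircuit (Zmat r) C
  binary C = ⇔-trans (circuits C) (φ⇔VecCircuit 3≤r C)
  spike : ∀ C → Circuit M C ⇔ (𝒞₁ r C ⊎ 𝒞₂ r C ⊎ φ₃ r C ⊎ 𝒞₄ r (φ₃ r) C)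
  spike C = ⇔-trans (circuits C) (φ⇔spikeCircuit (<⇒≤ 3≤r) C)
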